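{- Let $n\geq 26$. Let $G$ be a graph of order $n$ obtained from a cycle $C_n$ by adding three new edges $uv, vw, wu$, where $u,v,w$ are vertices of $C_n$ and none of these three edges belongs to $E(C_n)$, so that the added edges form a triangle. Then $W(G) < W(C_{n,3})$.
   Context: All graphs are finite and simple. For a connected graph $G$, the Wiener index is $W(G)=\sum_{\{x,y\}\subseteq V(G)} d_G(x,y)$, summing the shortest-path distances over all unordered pairs of distinct vertices. For $n\ge 5$, $C_{n,3}$ is the graph of order $n$ obtained from disjoint cycles $C_3$ and $C_{n-2}$ by identifying one vertex of $C_3$ with one vertex of $C_{n-2}$. -}

module Defs where

open import Data.Bool using (Bool; true; false; _∧_; _∨_; if_then_else_)
open import Data.Nat using (ℕ; zero; suc; _+_; _∸_; _<ᵇ_; _≡ᵇ_)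
open import Data.Fin using (Fin; toℕ)
open import Data.List using (List; map; concatMap; filter; allFin)
open import Data.Bool.ListAction using (any)
open import Data.Nat.ListAction using (sum)
open import Data.Nat using (_<?_)

Graph : ℕ → Set
Graph n = Fin n → Fin n → Bool

reach : ∀ {n} → Graph n → ℕ → Fin n → Fin n → Bool
reach {n} G zero    x y = toℕ x ≡ᵇ toℕ y
reach {n} G (suc k) x y = reach G k x y ∨ any (λ z → reach G k x z ∧ G z y) (allFin n)

distAux : ∀ {n} → Graph n → Fin n → Fin n → ℕ → ℕ → ℕ
distAux G x y zero       k = k
distAux G x y (suc fuel) k = if reach G k x y then k else distAux G x y fuel (suc k)

-- In a connected graph on n vertices this is < n, so searching
-- k = 0 .. n suffices (the value n only arises for disconnected pairs).
dist : ∀ {n} → Graph n → Fin n → Fin n → ℕ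
dist {n} G x y = distAux G x y n 0

wiener : ∀ {n} → Graph n → ℕ
wiener {n} G =
  sum (concatMap (λ x → map (λ y → dist G x y)
                            (filter (λ y → toℕ x <? toℕ y) (allFin n)))
                 (allFin n))

-- a ~ b in the cycle 0 - 1 - ... - (m-1) - 0 (vertex labels in ℕ, assumed < m).
cycAdjℕ : ℕ → ℕ → ℕ → Bool
cycAdjℕ m a b = ((suc a ≡ᵇ b) ∨ ((suc a ≡ᵇ m) ∧ (b ≡ᵇ 0)))
              ∨ ((suc b ≡ᵇ a) ∨ ((suc b ≡ᵇ m) ∧ (a ≡ᵇ 0)))

samePair : ℕ → ℕ → ℕ → ℕ → Bool
samePair a b x y = ((a ≡ᵇ x) ∧ (b ≡ᵇ y)) ∨ ((a ≡ᵇ y) ∧ (b ≡ᵇ x))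

cycleGraph : (n : ℕ) → Graph n
cycleGraph n i j = cycAdjℕ n (toℕ i) (toℕ j)

cycleTriangle : (n : ℕ) → Fin n → Fin n → Fin n → Graph n
cycleTriangle n u v w i j =
  cycleGraph n i j
  ∨ samePair (toℕ i) (toℕ j) (toℕ u) (toℕ v)
  ∨ samePair (toℕ i) (toℕ j) (toℕ v) (toℕ w)
  ∨ samePair (toℕ i) (toℕ j) (toℕ w) (toℕ u)

-- C_{n,3}: the cycle C_{n-2} on vertices 0..n-3 and the triangle on vertices
-- 0, n-2, n-1, sharing the vertex 0.
Cn3 : (n : ℕ) → Graph n
Cn3 n i j =
  ((a <ᵇ m) ∧ (b <ᵇ m) ∧ cycAdjℕ m a b)
  ∨ samePair a b 0 m
  ∨ samePair a b 0 (suc m)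
  ∨ samePair a b m (suc m)
  where
    m = n ∸ 2
    a = toℕ i
    b = toℕ j

-- Some edge {p, q} of the triangle is balanced: it cuts C_n into two arcs of lengths c, d ≥ 4. (The
-- three arcs cut off by u, v, w have lengths ≥ 2 and sum to n, or else their complements do.) Adding
-- edges only shortens distances, so W(G) ≤ W(C_n + pq), and in C_n + pq every distance is at most
-- the distance within one of the cycles C_{c+1}, C_{d+1} closed by the chord, or the distance to the
-- nearer chord end plus the distance along the other cycle. Summing these bounds expresses them
-- through the status s(N) = ⌊N²/4⌋ of a cycle. Dually, a 1-Lipschitz potential bounds W(C_{n,3}) from
-- below by a status expression, and the two estimates differ by a polynomial in c and d that is
-- positive once n ≥ 10.

module Submission where

open import Data.Bool using (Bool; true; false; _∧_; _∨_; if_then_else_; T)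
open import Data.Bool.ListAction using (any)
open import Data.Bool.Properties using (∨-comm; ∧-comm)
open import Data.Empty using (⊥-elim)
open import Data.Fin as Fin using (Fin; toℕ)
open import Data.Fin.Properties using (toℕ<n; toℕ-injective)
open import Data.List using (List; []; _∷_; map; concatMap; filter; allFin; tabulate)
open import Data.List.Membership.Propositional using (_∈_)
open import Data.List.Membership.Propositional.Properties using (∈-allFin)
open import Data.List.Properties using (map-tabulate; map-cong)
open import Data.List.Relation.Unary.Any using (here; there)
open import Data.Nat
open import Data.Nat.DivMod using (m<n⇒m%n≡m; [m+kn]%n≡m%n)
open import Data.Nat.ListAction using (sum)
open import Data.Nat.ListAction.Properties using (sum-++)
open import Data.Nat.Properties
open import Algebra.Properties.CommutativeSemigroup +-commutativeSemigroup using (interchange)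
open import Data.Nat.Tactic.RingSolver using (solve-∀)
open import Data.Product using (Σ; _×_; _,_; proj₂)
open import Data.Sum as Sum using (_⊎_; inj₁; inj₂)
open import Function using (_∘_)
open import Level using (0ℓ)
open import Relation.Binary.Definitions using (tri<; tri≈; tri>)
open import Relation.Binary.PropositionalEquality
open import Relation.Nullary using (yes; no; does)
open import Relation.Unary using (Pred; Decidable)
open import Defs

-- Finite sums

∑ : ℕ → (ℕ → ℕ) → ℕ
∑ zero    f = 0
∑ (suc n) f = f 0 + ∑ n (λ i → f (suc i))

∑-split : ∀ m n f → ∑ (m + n) f ≡ ∑ m f + ∑ n (λ i → f (m + i))
∑-split zero    n f = refl
∑-split (suc m) n f rewrite ∑-split m n (λ i → f (suc i)) = sym (+-assoc (f 0) _ _)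

∑-last : ∀ n f → ∑ (suc n) f ≡ ∑ n f + f n
∑-last zero    f = +-comm (f 0) 0
∑-last (suc n) f rewrite ∑-last n (λ i → f (suc i)) = sym (+-assoc (f 0) _ _)

∑-cong : ∀ n {f g} → (∀ i → i < n → f i ≡ g i) → ∑ n f ≡ ∑ n g
∑-cong zero    eq = refl
∑-cong (suc n) eq = cong₂ _+_ (eq 0 z<s) (∑-cong n (λ i i<n → eq (suc i) (s<s i<n)))

∑-mono-≤ : ∀ n {f g} → (∀ i → i < n → f i ≤ g i) → ∑ n f ≤ ∑ n g
∑-mono-≤ zero    le = z≤n
∑-mono-≤ (suc n) le = +-mono-≤ (le 0 z<s) (∑-mono-≤ n (λ i i<n → le (suc i) (s<s i<n)))

∑-distrib-+ : ∀ n f g → ∑ n (λ i → f i + g i) ≡ ∑ n f + ∑ n g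
∑-distrib-+ zero    f g = refl
∑-distrib-+ (suc n) f g rewrite ∑-distrib-+ n (λ i → f (suc i)) (λ i → g (suc i)) =
  interchange (f 0) (g 0) _ _

∑-*-distribˡ : ∀ n k f → ∑ n (λ i → k * f i) ≡ k * ∑ n f
∑-*-distribˡ zero    k f = sym (*-zeroʳ k)
∑-*-distribˡ (suc n) k f rewrite ∑-*-distribˡ n k (λ i → f (suc i)) = sym (*-distribˡ-+ k (f 0) _)

∑-const : ∀ n k → ∑ n (λ _ → k) ≡ n * k
∑-const zero    k = refl
∑-const (suc n) k = cong (k +_) (∑-const n k)

∑-zero : ∀ n → ∑ n (λ _ → 0) ≡ 0
∑-zero n = trans (∑-const n 0) (*-zeroʳ n)

∑-suc : ∀ n f → ∑ n (λ i → suc (f i)) ≡ n + ∑ n f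
∑-suc n f = trans (∑-distrib-+ n (λ _ → 1) f) (cong (_+ ∑ n f) (trans (∑-const n 1) (*-identityʳ n)))

∑-+1 : ∀ n f → ∑ n (λ i → f i + 1) ≡ ∑ n f + n
∑-+1 n f = trans (∑-distrib-+ n f (λ _ → 1)) (cong (∑ n f +_) (trans (∑-const n 1) (*-identityʳ n)))

∑-comm : ∀ m n (f : ℕ → ℕ → ℕ) → ∑ m (λ a → ∑ n (f a)) ≡ ∑ n (λ b → ∑ m (λ a → f a b))
∑-comm zero    n f = sym (∑-zero n)
∑-comm (suc m) n f = begin
  ∑ n (f 0) + ∑ m (λ a → ∑ n (f (suc a)))         ≡⟨ cong (∑ n (f 0) +_) (∑-comm m n (λ a → f (suc a))) ⟩
  ∑ n (f 0) + ∑ n (λ b → ∑ m (λ a → f (suc a) b)) ≡⟨ ∑-distrib-+ n (f 0) _ ⟨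
  ∑ n (λ b → f 0 b + ∑ m (λ a → f (suc a) b))     ∎
  where open ≡-Reasoning

∑-suc-suc : ∀ m f → ∑ (suc (suc m)) f ≡ ∑ m f + f m + f (suc m)
∑-suc-suc m f = trans (∑-last (suc m) f) (cong (_+ f (suc m)) (∑-last m f))

∑-affine : ∀ m A B C f → ∑ m (λ i → A + B * f i + C) ≡ m * (A + C) + B * ∑ m f
∑-affine m A B C f = begin
  ∑ m (λ i → A + B * f i + C)              ≡⟨ ∑-cong m (λ i _ → shuffle A B C (f i)) ⟩
  ∑ m (λ i → (A + C) + B * f i)            ≡⟨ ∑-distrib-+ m _ _ ⟩
  ∑ m (λ _ → A + C) + ∑ m (λ i → B * f i)  ≡⟨ cong₂ _+_ (∑-const m (A + C)) (∑-*-distribˡ m B f) ⟩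
  m * (A + C) + B * ∑ m f                  ∎
  where
  open ≡-Reasoning
  shuffle : ∀ A B C x → A + B * x + C ≡ (A + C) + B * x
  shuffle = solve-∀

-- Arcs of a cycle

arc : ℕ → ℕ → ℕ → ℕ
arc N a b with b <? a
... | yes _ = N + b ∸ a
... | no  _ = b ∸ a

arc-≥ : ∀ N a b → a ≤ b → arc N a b ≡ b ∸ a
arc-≥ N a b a≤b with b <? a
... | yes b<a = ⊥-elim (<⇒≱ b<a a≤b)
... | no  _   = refl

arc-< : ∀ N a b → b < a → arc N a b ≡ N + b ∸ a
arc-< N a b b<a with b <? a
... | yes _   = refl
... | no  b≮a = ⊥-elim (b≮a b<a)

arc-self : ∀ N a → arc N a a ≡ 0
arc-self N a = trans (arc-≥ N a a ≤-refl) (n∸n≡0 a)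

arc-zero : ∀ N b → arc N 0 b ≡ b
arc-zero N b = arc-≥ N 0 b z≤n

arc-cases : ∀ N a b → a ≤ N → (a + arc N a b ≡ b) ⊎ (a + arc N a b ≡ b + N)
arc-cases N a b a≤N with b <? a
... | yes _   = inj₂ (trans (m+[n∸m]≡n (≤-trans a≤N (m≤m+n N b))) (+-comm N b))
... | no  b≮a = inj₁ (m+[n∸m]≡n (≮⇒≥ b≮a))

arc<N : ∀ N a b → a ≤ N → b < N → arc N a b < N
arc<N N a b a≤N b<N with b <? a
... | yes b<a = +-cancelˡ-< a _ N (begin-strict
      a + (N + b ∸ a) ≡⟨ m+[n∸m]≡n (≤-trans a≤N (m≤m+n N b)) ⟩
      N + b           <⟨ +-monoʳ-< N b<a ⟩
      N + a           ≡⟨ +-comm N a ⟩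
      a + N           ∎)
  where open ≤-Reasoning
... | no  _   = ≤-<-trans (m∸n≤m b a) b<N

arc-winding : ∀ N a b → a ≤ N → Σ ℕ λ j → a + arc N a b ≡ b + j * N
arc-winding N a b a≤N with arc-cases N a b a≤N
... | inj₁ eq = 0 , trans eq (sym (+-identityʳ b))
... | inj₂ eq = 1 , trans eq (cong (b +_) (sym (+-identityʳ N)))

residue-unique : ∀ {N} s u j l → s + j * N ≡ u + l * N → s < N → u < N → s ≡ u
residue-unique {suc N} s u j l eq s<N u<N = begin
  s                      ≡⟨ m<n⇒m%n≡m s<N ⟨
  s % suc N              ≡⟨ [m+kn]%n≡m%n s j (suc N) ⟨
  (s + j * suc N) % suc N ≡⟨ cong (_% suc N) eq ⟩
  (u + l * suc N) % suc N ≡⟨ [m+kn]%n≡m%n u l (suc N) ⟩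
  u % suc N              ≡⟨ m<n⇒m%n≡m u<N ⟩
  u                      ∎
  where open ≡-Reasoning

arc-unique : ∀ {N a b s} j l → a ≤ N → b < N → s < N →
             a + s + j * N ≡ b + l * N → arc N a b ≡ s
arc-unique {N} {a} {b} {s} j l a≤N b<N s<N eq with arc-winding N a b a≤N
... | k , wind = residue-unique (arc N a b) s l (j + k) (+-cancelˡ-≡ a _ _ (begin
  a + (arc N a b + l * N) ≡⟨ +-assoc a _ _ ⟨
  a + arc N a b + l * N   ≡⟨ cong (_+ l * N) wind ⟩
  b + k * N + l * N       ≡⟨ shuffle b k l N ⟩
  b + l * N + k * N       ≡⟨ cong (_+ k * N) eq ⟨
  a + s + j * N + k * N   ≡⟨ regroup a s j k N ⟩
  a + (s + (j + k) * N)   ∎)) (arc<N N a b a≤N b<N) s<N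
  where
  open ≡-Reasoning
  shuffle : ∀ b k l N → b + k * N + l * N ≡ b + l * N + k * N
  shuffle = solve-∀
  regroup : ∀ a s j k N → a + s + j * N + k * N ≡ a + (s + (j + k) * N)
  regroup = solve-∀

arc-inverse : ∀ N a b → a < N → b < N → arc N (N ∸ a) (arc N a b) ≡ b
arc-inverse N a b a<N b<N with arc-winding N a b (<⇒≤ a<N)
... | j , wind = arc-unique j 1 (m∸n≤m N a) (arc<N N a b (<⇒≤ a<N) b<N) b<N (begin
  r + b + j * N   ≡⟨ +-assoc r b _ ⟩
  r + (b + j * N) ≡⟨ cong (r +_) wind ⟨
  r + (a + t)     ≡⟨ regroup r a t ⟩
  (a + r) + t     ≡⟨ cong (_+ t) (m+[n∸m]≡n (<⇒≤ a<N)) ⟩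
  N + t           ≡⟨ +-comm N t ⟩
  t + N           ≡⟨ cong (t +_) (+-identityʳ N) ⟨
  t + 1 * N       ∎)
  where
  open ≡-Reasoning
  r = N ∸ a
  t = arc N a b
  regroup : ∀ r a t → r + (a + t) ≡ (a + r) + t
  regroup = solve-∀

arc-trans : ∀ N p q x → p < N → q < N → x < N → arc N (arc N p q) (arc N p x) ≡ arc N q x
arc-trans N p q x p<N q<N x<N
  with arc-winding N p q (<⇒≤ p<N) | arc-winding N p x (<⇒≤ p<N) | arc-winding N q x (<⇒≤ q<N)
... | j₁ , w₁ | j₂ , w₂ | j₃ , w₃ =
  arc-unique j₂ (j₁ + j₃) (<⇒≤ (arc<N N p q (<⇒≤ p<N) q<N)) (arc<N N p x (<⇒≤ p<N) x<N)
             (arc<N N q x (<⇒≤ q<N) x<N) (+-cancelˡ-≡ p _ _ (begin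
  p + (c + s + j₂ * N)          ≡⟨ regroup₁ p c s (j₂ * N) ⟩
  (p + c) + s + j₂ * N          ≡⟨ cong (λ z → z + s + j₂ * N) w₁ ⟩
  q + j₁ * N + s + j₂ * N       ≡⟨ regroup₂ q s (j₁ * N) (j₂ * N) ⟩
  (q + s) + j₁ * N + j₂ * N     ≡⟨ cong (λ z → z + j₁ * N + j₂ * N) w₃ ⟩
  x + j₃ * N + j₁ * N + j₂ * N  ≡⟨ regroup₃ x j₁ j₂ j₃ N ⟩
  (x + j₂ * N) + (j₁ + j₃) * N  ≡⟨ cong (_+ (j₁ + j₃) * N) w₂ ⟨
  (p + a) + (j₁ + j₃) * N       ≡⟨ +-assoc p a _ ⟩
  p + (a + (j₁ + j₃) * N)       ∎))
  where
  open ≡-Reasoning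
  c = arc N p q
  a = arc N p x
  s = arc N q x
  regroup₁ : ∀ p c s w → p + (c + s + w) ≡ (p + c) + s + w
  regroup₁ = solve-∀
  regroup₂ : ∀ q s v w → q + v + s + w ≡ (q + s) + v + w
  regroup₂ = solve-∀
  regroup₃ : ∀ x j₁ j₂ j₃ N → x + j₃ * N + j₁ * N + j₂ * N ≡ (x + j₂ * N) + (j₁ + j₃) * N
  regroup₃ = solve-∀

arc-pos : ∀ N p q → p < N → q < N → p ≢ q → 0 < arc N p q
arc-pos N p q p<N q<N p≢q with arc-winding N p q (<⇒≤ p<N)
... | j , wind = n≢0⇒n>0 λ arc≡0 → p≢q (residue-unique p q 0 j (trans (cong (p +_) (sym arc≡0)) wind) p<N q<N)

arc-flip : ∀ N p q → p < N → q < N → p ≢ q → arc N q p ≡ N ∸ arc N p q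
arc-flip N p q p<N q<N p≢q with arc-winding N p q (<⇒≤ p<N)
... | j , wind = arc-unique j 1 (<⇒≤ q<N) p<N (∸-monoʳ-< (arc-pos N p q p<N q<N p≢q) (<⇒≤ c<N)) (begin
  q + s + j * N   ≡⟨ regroup q s (j * N) ⟩
  (q + j * N) + s ≡⟨ cong (_+ s) wind ⟨
  p + c + s       ≡⟨ +-assoc p c s ⟩
  p + (c + s)     ≡⟨ cong (p +_) (m+[n∸m]≡n (<⇒≤ c<N)) ⟩
  p + N           ≡⟨ cong (p +_) (+-identityʳ N) ⟨
  p + 1 * N       ∎)
  where
  open ≡-Reasoning
  c = arc N p q
  s = N ∸ c
  c<N = arc<N N p q (<⇒≤ p<N) q<N
  regroup : ∀ q s w → q + s + w ≡ (q + w) + s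
  regroup = solve-∀

arc-beyond : ∀ n p q y → p < n → q < n → y < n → p ≢ q → arc n p q < arc n p y → arc n q y ≤ arc n q p
arc-beyond n p q y p<n q<n y<n p≢q c<b = begin
  arc n q y                   ≡⟨ arc-trans n p q y p<n q<n y<n ⟨
  arc n (arc n p q) (arc n p y) ≡⟨ arc-≥ n _ _ (<⇒≤ c<b) ⟩
  arc n p y ∸ arc n p q       ≤⟨ ∸-monoˡ-≤ (arc n p q) (<⇒≤ (arc<N n p y (<⇒≤ p<n) y<n)) ⟩
  n ∸ arc n p q               ≡⟨ arc-flip n p q p<n q<n p≢q ⟨
  arc n q p                   ∎
  where open ≤-Reasoning

arc-offset : ∀ n c i → arc n c (suc c + i) ≡ suc i
arc-offset n c i = trans (arc-≥ n c (suc c + i) (m≤n⇒m≤1+n (m≤m+n c i)))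
                         (trans (cong (_∸ c) (sym (+-suc c i))) (m+n∸m≡n c (suc i)))

∑-rotate : ∀ N a f → a ≤ N → ∑ N (λ b → f (arc N a b)) ≡ ∑ N f
∑-rotate N a f a≤N = begin
  ∑ N (λ b → f (arc N a b))                             ≡⟨ cong (λ k → ∑ k (λ b → f (arc N a b))) a+d≡N ⟨
  ∑ (a + d) (λ b → f (arc N a b))                       ≡⟨ ∑-split a d _ ⟩
  ∑ a (λ b → f (arc N a b)) + ∑ d (λ i → f (arc N a (a + i))) ≡⟨ cong₂ _+_ (∑-cong a wrapped) (∑-cong d unwrapped) ⟩
  ∑ a (λ i → f (d + i)) + ∑ d f                         ≡⟨ +-comm (∑ a (λ i → f (d + i))) (∑ d f) ⟩
  ∑ d f + ∑ a (λ i → f (d + i))                         ≡⟨ ∑-split d a f ⟨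
  ∑ (d + a) f                                           ≡⟨ cong (λ k → ∑ k f) (trans (+-comm d a) a+d≡N) ⟩
  ∑ N f                                                 ∎
  where
  open ≡-Reasoning
  d = N ∸ a
  a+d≡N : a + d ≡ N
  a+d≡N = m+[n∸m]≡n a≤N
  wrapped : ∀ i → i < a → f (arc N a i) ≡ f (d + i)
  wrapped i i<a = cong f (begin
    arc N a i     ≡⟨ arc-< N a i i<a ⟩
    N + i ∸ a     ≡⟨ cong (λ k → k + i ∸ a) a+d≡N ⟨
    a + d + i ∸ a ≡⟨ cong (_∸ a) (+-assoc a d i) ⟩
    a + (d + i) ∸ a ≡⟨ m+n∸m≡n a (d + i) ⟩
    d + i         ∎)
  unwrapped : ∀ i → i < d → f (arc N a (a + i)) ≡ f i
  unwrapped i _ = cong f (trans (arc-≥ N a (a + i) (m≤m+n a i)) (m+n∸m≡n a i))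

data Next (N : ℕ) : ℕ → ℕ → Set where
  next-step : ∀ {t} → suc t < N → Next N t (suc t)
  next-wrap : ∀ {t} → suc t ≡ N → Next N t 0

next-winding : ∀ {N a b} → Next N a b → Σ ℕ λ l → suc a ≡ b + l * N
next-winding (next-step _)  = 0 , sym (+-identityʳ _)
next-winding (next-wrap eq) = 1 , trans eq (sym (+-identityʳ _))

next-target< : ∀ {N a b} → a < N → Next N a b → b < N
next-target< a<N (next-step sa<N) = sa<N
next-target< a<N (next-wrap _)    = ≤-<-trans z≤n a<N

arc-next : ∀ {N a b} c → c ≤ N → a < N → Next N a b → Next N (arc N c a) (arc N c b)
arc-next {N} {a} {b} c c≤N a<N nx with arc-winding N c a c≤N | next-winding nx | m≤n⇒m<n∨m≡n (arc<N N c a c≤N a<N)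
... | j , wind | l , step | inj₁ st<N =
  subst (Next N t) (sym (arc-unique 0 (l + j) c≤N b<N st<N (begin
    c + suc t + 0 * N ≡⟨ +-identityʳ _ ⟩
    c + suc t         ≡⟨ +-suc c t ⟩
    suc (c + t)       ≡⟨ cong suc wind ⟩
    suc a + j * N     ≡⟨ cong (_+ j * N) step ⟩
    b + l * N + j * N ≡⟨ regroup b l j N ⟩
    b + (l + j) * N   ∎))) (next-step st<N)
  where
  open ≡-Reasoning
  t = arc N c a
  b<N = next-target< a<N nx
  regroup : ∀ b l j N → b + l * N + j * N ≡ b + (l + j) * N
  regroup = solve-∀
... | j , wind | l , step | inj₂ st≡N =
  subst (Next N t) (sym (arc-unique 1 (l + j) c≤N b<N (≤-<-trans z≤n a<N) (begin
    c + 0 + 1 * N     ≡⟨ unit c N ⟩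
    c + N             ≡⟨ cong (c +_) st≡N ⟨
    c + suc t         ≡⟨ +-suc c t ⟩
    suc (c + t)       ≡⟨ cong suc wind ⟩
    suc a + j * N     ≡⟨ cong (_+ j * N) step ⟩
    b + l * N + j * N ≡⟨ regroup b l j N ⟩
    b + (l + j) * N   ∎))) (next-wrap st≡N)
  where
  open ≡-Reasoning
  t = arc N c a
  b<N = next-target< a<N nx
  unit : ∀ c N → c + 0 + 1 * N ≡ c + N
  unit = solve-∀
  regroup : ∀ b l j N → b + l * N + j * N ≡ b + (l + j) * N
  regroup = solve-∀

next-pred : ∀ {N b} → b < N → Σ ℕ λ b′ → b′ < N × Next N b′ b
next-pred {suc N} {zero}  _   = N , ≤-refl , next-wrap refl
next-pred {N}     {suc b} b<N = b , <-trans (n<1+n b) b<N , next-step b<N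

next-suc⁻ : ∀ {N s t} → Next N s (suc t) → s ≡ t
next-suc⁻ (next-step _) = refl

-- Distances in a cycle

-- Distance in C_N between two vertices whose forward arc is t.
cycDist : ℕ → ℕ → ℕ
cycDist N t = t ⊓ (N ∸ t)

cycDist-reflect : ∀ {N} t t' → t + t' ≡ N → cycDist N t' ≡ cycDist N t
cycDist-reflect {N} t t' eq = begin
  t' ⊓ (N ∸ t') ≡⟨ cong (t' ⊓_) (trans (cong (_∸ t') (sym eq)) (m+n∸n≡m t t')) ⟩
  t' ⊓ t        ≡⟨ ⊓-comm t' t ⟩
  t ⊓ t'        ≡⟨ cong (t ⊓_) (trans (cong (_∸ t) (sym eq)) (m+n∸m≡n t t')) ⟨
  t ⊓ (N ∸ t)   ∎
  where open ≡-Reasoning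

cycDist-arc-comm : ∀ N a b → a < N → b < N → cycDist N (arc N a b) ≡ cycDist N (arc N b a)
cycDist-arc-comm N a b a<N b<N with a ≟ b
... | yes refl = refl
... | no  a≢b  rewrite arc-flip N a b a<N b<N a≢b =
  sym (cycDist-reflect (arc N a b) _ (m+[n∸m]≡n (<⇒≤ (arc<N N a b (<⇒≤ a<N) b<N))))

cycDist-next-≤ : ∀ {N t t'} → Next N t t' → cycDist N t' ≤ suc (cycDist N t)
cycDist-next-≤ {N} {t} (next-step _) =
  ⊓-monoʳ-≤ (suc t) (≤-trans (∸-monoʳ-≤ N (n≤1+n t)) (n≤1+n (N ∸ t)))
cycDist-next-≤ (next-wrap _) = z≤n

cycDist-prev-≤ : ∀ {N t t'} → Next N t t' → cycDist N t ≤ suc (cycDist N t')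
cycDist-prev-≤ {N} {t} (next-step st<N) = begin
  t ⊓ (N ∸ t)             ≤⟨ ⊓-monoˡ-≤ (N ∸ t) (m≤n+m t 2) ⟩
  suc (suc t) ⊓ (N ∸ t)   ≡⟨ cong (suc (suc t) ⊓_) (+-∸-assoc 1 (<⇒≤ st<N)) ⟩
  suc (suc t ⊓ (N ∸ suc t)) ∎
  where open ≤-Reasoning
cycDist-prev-≤ {t = t} (next-wrap refl) =
  ≤-trans (m⊓n≤n t (suc t ∸ t)) (≤-reflexive (m+n∸n≡m 1 t))

cycDist-full : ∀ N → cycDist N N ≡ 0
cycDist-full N = trans (cong (N ⊓_) (n∸n≡0 N)) (⊓-zeroʳ N)

cycDist≤ : ∀ N t → cycDist N t ≤ N
cycDist≤ N t = ≤-trans (m⊓n≤n t (N ∸ t)) (m∸n≤m N t)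

cycDist-near : ∀ c a → 2 * a ≤ c → cycDist c a ≡ a
cycDist-near c a 2a≤c = m≤n⇒m⊓n≡m (subst (_≤ c ∸ a) (m+n∸n≡m a a)
                          (∸-monoˡ-≤ a (subst (_≤ c) (cong (a +_) (+-identityʳ a)) 2a≤c)))

cycDist-far : ∀ c a → c < 2 * a → cycDist c a ≡ c ∸ a
cycDist-far c a c<2a = m≥n⇒m⊓n≡n (subst (c ∸ a ≤_) (m+n∸n≡m a a)
                         (∸-monoˡ-≤ a (<⇒≤ (subst (c <_) (cong (a +_) (+-identityʳ a)) c<2a))))

cycDist-arc-≤ : ∀ N {a b} → a ≤ b → cycDist N (arc N a b) ≤ b ∸ a
cycDist-arc-≤ N {a} {b} a≤b rewrite arc-≥ N a b a≤b = m⊓n≤m (b ∸ a) _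

cycDist-arc-to-0 : ∀ N {a} → a < N → cycDist N (arc N a 0) ≤ a
cycDist-arc-to-0 N {a} a<N rewrite cycDist-arc-comm N a 0 a<N (≤-<-trans z≤n a<N) | arc-zero N a = m⊓n≤m a _

-- The status (sum of distances from one vertex) of C_N; it equals ⌊N²/4⌋.
status : ℕ → ℕ
status N = ∑ N (cycDist N)

status-suc-suc : ∀ N → status (suc (suc N)) ≡ status N + suc N
status-suc-suc N = begin
  ∑ (suc N) (λ t → cycDist (suc (suc N)) (suc t)) ≡⟨ ∑-cong (suc N) (λ t t<sN → shift t (≤-pred t<sN)) ⟩
  ∑ (suc N) (λ t → suc (cycDist N t))             ≡⟨ ∑-suc (suc N) (cycDist N) ⟩
  suc N + ∑ (suc N) (cycDist N)                   ≡⟨ cong (suc N +_) (∑-last N (cycDist N)) ⟩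
  suc N + (status N + cycDist N N)                ≡⟨ cong (λ z → suc N + (status N + z)) (cycDist-full N) ⟩
  suc N + (status N + 0)                          ≡⟨ cong (suc N +_) (+-identityʳ (status N)) ⟩
  suc N + status N                                ≡⟨ +-comm (suc N) (status N) ⟩
  status N + suc N                                ∎
  where
  open ≡-Reasoning
  shift : ∀ t → t ≤ N → cycDist (suc (suc N)) (suc t) ≡ suc (cycDist N t)
  shift t t≤N = cong (suc t ⊓_) (+-∸-assoc 1 t≤N)

4*status≤square : ∀ N → 4 * status N ≤ N * N
4*status≤square zero          = z≤n
4*status≤square (suc zero)    = z≤n
4*status≤square (suc (suc N)) = begin
  4 * status (suc (suc N))     ≡⟨ cong (4 *_) (status-suc-suc N) ⟩
  4 * (status N + suc N)       ≡⟨ *-distribˡ-+ 4 (status N) (suc N) ⟩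
  4 * status N + 4 * suc N     ≤⟨ +-monoˡ-≤ (4 * suc N) (4*status≤square N) ⟩
  N * N + 4 * suc N            ≡⟨ square-suc-suc N ⟩
  suc (suc N) * suc (suc N)    ∎
  where
  open ≤-Reasoning
  square-suc-suc : ∀ N → N * N + 4 * suc N ≡ suc (suc N) * suc (suc N)
  square-suc-suc = solve-∀

square≤4*status+1 : ∀ N → N * N ≤ 4 * status N + 1
square≤4*status+1 zero          = z≤n
square≤4*status+1 (suc zero)    = s≤s z≤n
square≤4*status+1 (suc (suc N)) = begin
  suc (suc N) * suc (suc N)       ≡⟨ square-suc-suc N ⟩
  N * N + 4 * suc N               ≤⟨ +-monoˡ-≤ (4 * suc N) (square≤4*status+1 N) ⟩
  4 * status N + 1 + 4 * suc N    ≡⟨ regroup (status N) N ⟩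
  4 * (status N + suc N) + 1      ≡⟨ cong (λ z → 4 * z + 1) (status-suc-suc N) ⟨
  4 * status (suc (suc N)) + 1    ∎
  where
  open ≤-Reasoning
  square-suc-suc : ∀ N → suc (suc N) * suc (suc N) ≡ N * N + 4 * suc N
  square-suc-suc = solve-∀
  regroup : ∀ r N → 4 * r + 1 + 4 * suc N ≡ 4 * (r + suc N) + 1
  regroup = solve-∀

∑-cycDist-closed : ∀ c → ∑ (suc c) (cycDist c) ≡ status c
∑-cycDist-closed c = begin
  ∑ (suc c) (cycDist c)       ≡⟨ ∑-last c (cycDist c) ⟩
  status c + cycDist c c      ≡⟨ cong (status c +_) (cycDist-full c) ⟩
  status c + 0                ≡⟨ +-identityʳ (status c) ⟩
  status c                    ∎
  where open ≡-Reasoning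

status-interior : ∀ M e → e ≡ 0 ⊎ e ≡ suc M →
                  ∑ M (λ i → cycDist (suc (suc M)) (arc (suc (suc M)) e (suc i))) + 1 ≡ status (suc (suc M))
status-interior M e end = begin
  ∑ M (h ∘ suc) + 1             ≡⟨ +-comm (∑ M (h ∘ suc)) 1 ⟩
  1 + ∑ M (h ∘ suc)             ≡⟨ cong (_+ ∑ M (h ∘ suc)) (ends end) ⟨
  h 0 + h (suc M) + ∑ M (h ∘ suc) ≡⟨ regroup (h 0) (h (suc M)) _ ⟩
  h 0 + (∑ M (h ∘ suc) + h (suc M)) ≡⟨ cong (h 0 +_) (∑-last M (h ∘ suc)) ⟨
  ∑ N h                         ≡⟨ ∑-rotate N e (cycDist N) (e≤N end) ⟩
  status N                      ∎
  where
  open ≡-Reasoning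
  N = suc (suc M)
  h : ℕ → ℕ
  h j = cycDist N (arc N e j)
  e≤N : e ≡ 0 ⊎ e ≡ suc M → e ≤ N
  e≤N (inj₁ refl) = z≤n
  e≤N (inj₂ refl) = n≤1+n (suc M)
  last : cycDist N (suc M) ≡ 1
  last rewrite m+n∸n≡m 1 M | ⊓-zeroʳ M = refl
  ends : e ≡ 0 ⊎ e ≡ suc M → h 0 + h (suc M) ≡ 1
  ends (inj₁ refl) = cong₂ _+_ (cong (cycDist N) (arc-self N 0)) (trans (cong (cycDist N) (arc-zero N (suc M))) last)
  ends (inj₂ refl) = cong₂ _+_ (trans (cycDist-arc-comm N (suc M) 0 ≤-refl z<s) (trans (cong (cycDist N) (arc-zero N (suc M))) last))
                               (cong (cycDist N) (arc-self N (suc M)))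
  regroup : ∀ x y z → x + y + z ≡ x + (z + y)
  regroup = solve-∀

∨-true⁺ˡ : ∀ {a} b → a ≡ true → a ∨ b ≡ true
∨-true⁺ˡ b refl = refl

∨-true⁺ʳ : ∀ a {b} → b ≡ true → a ∨ b ≡ true
∨-true⁺ʳ false refl = refl
∨-true⁺ʳ true  refl = refl

∨-true⁻ : ∀ a {b} → a ∨ b ≡ true → a ≡ true ⊎ b ≡ true
∨-true⁻ true  _  = inj₁ refl
∨-true⁻ false eq = inj₂ eq

∧-true⁺ : ∀ {a b} → a ≡ true → b ≡ true → a ∧ b ≡ true
∧-true⁺ refl refl = refl

∧-true⁻ : ∀ a {b} → a ∧ b ≡ true → a ≡ true × b ≡ true
∧-true⁻ true eq = refl , eq

∧-swap : ∀ a b c → a ∧ (b ∧ c) ≡ b ∧ (a ∧ c)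
∧-swap true  true  c = refl
∧-swap true  false c = refl
∧-swap false true  c = refl
∧-swap false false c = refl

T⇒≡true : ∀ {b} → T b → b ≡ true
T⇒≡true {true} _ = refl

≡true⇒T : ∀ {b} → b ≡ true → T b
≡true⇒T refl = _

≡ᵇ-refl : ∀ a → (a ≡ᵇ a) ≡ true
≡ᵇ-refl a = T⇒≡true (≡⇒≡ᵇ a a refl)

≡ᵇ-true⁻ : ∀ a b → (a ≡ᵇ b) ≡ true → a ≡ b
≡ᵇ-true⁻ a b eq = ≡ᵇ⇒≡ a b (≡true⇒T eq)

≡ᵇ-false⁺ : ∀ a b → a ≢ b → (a ≡ᵇ b) ≡ false
≡ᵇ-false⁺ a b a≢b with a ≡ᵇ b in eq
... | false = refl
... | true  = ⊥-elim (a≢b (≡ᵇ-true⁻ a b eq))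

<ᵇ-true⁺ : ∀ {a b} → a < b → (a <ᵇ b) ≡ true
<ᵇ-true⁺ a<b = T⇒≡true (<⇒<ᵇ a<b)

<ᵇ-true⁻ : ∀ a b → (a <ᵇ b) ≡ true → a < b
<ᵇ-true⁻ a b eq = <ᵇ⇒< a b (≡true⇒T eq)

<ᵇ-false⁺ : ∀ {a b} → b ≤ a → (a <ᵇ b) ≡ false
<ᵇ-false⁺ {a} {b} b≤a with a <ᵇ b in eq
... | false = refl
... | true  = ⊥-elim (<⇒≱ (<ᵇ-true⁻ a b eq) b≤a)

≤ᵇ-true⁺ : ∀ {a b} → a ≤ b → (a ≤ᵇ b) ≡ true
≤ᵇ-true⁺ a≤b = T⇒≡true (≤⇒≤ᵇ a≤b)

≤ᵇ-false⁺ : ∀ {a b} → b < a → (a ≤ᵇ b) ≡ false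
≤ᵇ-false⁺ {a} {b} b<a with a ≤ᵇ b in eq
... | false = refl
... | true  = ⊥-elim (<⇒≱ b<a (≤ᵇ⇒≤ a b (≡true⇒T eq)))

any-true⁺ : ∀ {A : Set} (p : A → Bool) {z} {xs : List A} → z ∈ xs → p z ≡ true → any p xs ≡ true
any-true⁺ p {xs = x ∷ xs} (here refl) eq = ∨-true⁺ˡ _ eq
any-true⁺ p {xs = x ∷ xs} (there z∈xs) eq = ∨-true⁺ʳ (p x) (any-true⁺ p z∈xs eq)

any-true⁻ : ∀ {A : Set} (p : A → Bool) (xs : List A) → any p xs ≡ true → Σ A λ z → p z ≡ true
any-true⁻ p (x ∷ xs) eq with ∨-true⁻ (p x) eq
... | inj₁ px = x , px
... | inj₂ rest = any-true⁻ p xs rest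

cycAdj-comm : ∀ m a b → cycAdjℕ m a b ≡ cycAdjℕ m b a
cycAdj-comm m a b = ∨-comm ((suc a ≡ᵇ b) ∨ ((suc a ≡ᵇ m) ∧ (b ≡ᵇ 0))) _

cycAdj⁺ : ∀ {m a b} → Next m a b → cycAdjℕ m a b ≡ true
cycAdj⁺ {a = a} (next-step _)    rewrite ≡ᵇ-refl (suc a) = refl
cycAdj⁺ {a = a} (next-wrap refl) rewrite ≡ᵇ-refl (suc a) = refl

next-step′ : ∀ {m a b} → suc a ≡ b → b < m → Next m a b
next-step′ refl b<m = next-step b<m

next-wrap′ : ∀ {m a b} → suc a ≡ m → b ≡ 0 → Next m a b
next-wrap′ sa≡m refl = next-wrap sa≡m

cycAdj⁻ : ∀ m a b → a < m → b < m → cycAdjℕ m a b ≡ true → Next m a b ⊎ Next m b a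
cycAdj⁻ m a b a<m b<m adj with ∨-true⁻ ((suc a ≡ᵇ b) ∨ ((suc a ≡ᵇ m) ∧ (b ≡ᵇ 0))) adj
... | inj₁ fwd with ∨-true⁻ (suc a ≡ᵇ b) fwd
...   | inj₁ sa≡b  = inj₁ (next-step′ (≡ᵇ-true⁻ _ _ sa≡b) b<m)
...   | inj₂ wraps = let sa≡m , b≡0 = ∧-true⁻ (suc a ≡ᵇ m) wraps
                     in inj₁ (next-wrap′ (≡ᵇ-true⁻ _ _ sa≡m) (≡ᵇ-true⁻ b 0 b≡0))
cycAdj⁻ m a b a<m b<m adj | inj₂ bwd with ∨-true⁻ (suc b ≡ᵇ a) bwd
...   | inj₁ sb≡a  = inj₂ (next-step′ (≡ᵇ-true⁻ _ _ sb≡a) a<m)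
...   | inj₂ wraps = let sb≡m , a≡0 = ∧-true⁻ (suc b ≡ᵇ m) wraps
                     in inj₂ (next-wrap′ (≡ᵇ-true⁻ _ _ sb≡m) (≡ᵇ-true⁻ a 0 a≡0))

samePair-refl : ∀ a b → samePair a b a b ≡ true
samePair-refl a b rewrite ≡ᵇ-refl a | ≡ᵇ-refl b = refl

samePair-comm : ∀ a b x y → samePair a b x y ≡ samePair b a x y
samePair-comm a b x y =
  trans (cong₂ _∨_ (∧-comm (a ≡ᵇ x) (b ≡ᵇ y)) (∧-comm (a ≡ᵇ y) (b ≡ᵇ x)))
        (∨-comm ((b ≡ᵇ y) ∧ (a ≡ᵇ x)) _)

samePair⁻ : ∀ a b x y → samePair a b x y ≡ true → (a ≡ x × b ≡ y) ⊎ (a ≡ y × b ≡ x)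
samePair⁻ a b x y eq with ∨-true⁻ ((a ≡ᵇ x) ∧ (b ≡ᵇ y)) eq
... | inj₁ straight = let a≡x , b≡y = ∧-true⁻ (a ≡ᵇ x) straight
                      in inj₁ (≡ᵇ-true⁻ a x a≡x , ≡ᵇ-true⁻ b y b≡y)
... | inj₂ crossed  = let a≡y , b≡x = ∧-true⁻ (a ≡ᵇ y) crossed
                      in inj₂ (≡ᵇ-true⁻ a y a≡y , ≡ᵇ-true⁻ b x b≡x)

-- Walks and distances

Undirected : ∀ {n} → Graph n → Set
Undirected G = ∀ i j → G i j ≡ G j i

module _ {n} (G : Graph n) where

  reach-suc : ∀ k x y → reach G k x y ≡ true → reach G (suc k) x y ≡ true
  reach-suc k x y r = ∨-true⁺ˡ _ r

  reach-step : ∀ k x z y → reach G k x z ≡ true → G z y ≡ true → reach G (suc k) x y ≡ true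
  reach-step k x z y r e =
    ∨-true⁺ʳ (reach G k x y) (any-true⁺ (λ w → reach G k x w ∧ G w y) (∈-allFin z) (∧-true⁺ r e))

  reach-step⁻ : ∀ k x y → reach G (suc k) x y ≡ true →
                reach G k x y ≡ true ⊎ Σ (Fin n) λ z → reach G k x z ≡ true × G z y ≡ true
  reach-step⁻ k x y r with ∨-true⁻ (reach G k x y) r
  ... | inj₁ r′ = inj₁ r′
  ... | inj₂ r′ = let z , e = any-true⁻ _ (allFin n) r′ in inj₂ (z , ∧-true⁻ (reach G k x z) e)

  reach-mono : ∀ {j} k x y → j ≤ k → reach G j x y ≡ true → reach G k x y ≡ true
  reach-mono zero    x y z≤n r = r
  reach-mono (suc k) x y j≤sk r with m≤n⇒m<n∨m≡n j≤sk
  ... | inj₁ j<sk  = reach-suc k x y (reach-mono k x y (≤-pred j<sk) r)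
  ... | inj₂ refl = r

  reach-zero⁻ : ∀ x y → reach G 0 x y ≡ true → x ≡ y
  reach-zero⁻ x y r = toℕ-injective (≡ᵇ-true⁻ (toℕ x) (toℕ y) r)

  reach-refl : ∀ k x → reach G k x x ≡ true
  reach-refl k x = reach-mono k x x z≤n (≡ᵇ-refl (toℕ x))

  reach-edge : ∀ x y → G x y ≡ true → reach G 1 x y ≡ true
  reach-edge x y e = reach-step 0 x x y (reach-refl 0 x) e

  reach-++ : ∀ j k {x z y} → reach G j x z ≡ true → reach G k z y ≡ true → reach G (j + k) x y ≡ true
  reach-++ j zero {x} {z} {y} r₁ r₂ rewrite reach-zero⁻ z y r₂ | +-identityʳ j = r₁
  reach-++ j (suc k) {x} {z} {y} r₁ r₂ rewrite +-suc j k with reach-step⁻ k z y r₂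
  ... | inj₁ r  = reach-suc (j + k) x y (reach-++ j k r₁ r)
  ... | inj₂ (w , r , e) = reach-step (j + k) x w y (reach-++ j k r₁ r) e

  reach-⊓ : ∀ j k {x y} → reach G j x y ≡ true → reach G k x y ≡ true → reach G (j ⊓ k) x y ≡ true
  reach-⊓ j k r₁ r₂ with ⊓-sel j k
  ... | inj₁ eq rewrite eq = r₁
  ... | inj₂ eq rewrite eq = r₂

  dist≤ : ∀ k x y → reach G k x y ≡ true → dist G x y ≤ k
  dist≤ k x y r = search n 0 z≤n
    where
    search : ∀ fuel start → start ≤ k → distAux G x y fuel start ≤ k
    search zero       start s≤k = s≤k
    search (suc fuel) start s≤k with reach G start x y in found
    ... | true  = s≤k
    ... | false with m≤n⇒m<n∨m≡n s≤k
    ...   | inj₁ s<k  = search fuel (suc start) s<k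
    ...   | inj₂ refl with trans (sym found) r
    ...     | ()

  potential≤dist : ∀ x (h : Fin n → ℕ) → h x ≡ 0 → (∀ z y → G z y ≡ true → h y ≤ suc (h z)) →
                   ∀ y → h y ≤ n → h y ≤ dist G x y
  potential≤dist x h hx≡0 lipschitz y hy≤n = search n 0 hy≤n
    where
    below-walks : ∀ {y} k → reach G k x y ≡ true → h y ≤ k
    below-walks {y} zero r rewrite sym (reach-zero⁻ x y r) | hx≡0 = z≤n
    below-walks {y} (suc k) r with reach-step⁻ k x y r
    ... | inj₁ r′ = m≤n⇒m≤1+n (below-walks k r′)
    ... | inj₂ (z , r′ , e) = ≤-trans (lipschitz z y e) (s≤s (below-walks k r′))
    search : ∀ fuel start → h y ≤ start + fuel → h y ≤ distAux G x y fuel start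
    search zero       start le = subst (h y ≤_) (+-identityʳ start) le
    search (suc fuel) start le with reach G start x y in found
    ... | true  = below-walks start found
    ... | false = search fuel (suc start) (subst (h y ≤_) (+-suc start fuel) le)

  dist-self : ∀ x → dist G x x ≡ 0
  dist-self x = n≤0⇒n≡0 (dist≤ 0 x x (reach-refl 0 x))

  module _ (undirected : Undirected G) where

    reach-sym : ∀ k x y → reach G k x y ≡ true → reach G k y x ≡ true
    reach-sym zero x y r rewrite reach-zero⁻ x y r = reach-refl 0 y
    reach-sym (suc k) x y r with reach-step⁻ k x y r
    ... | inj₁ r′ = reach-suc k y x (reach-sym k x y r′)
    ... | inj₂ (z , r′ , e) =
      reach-++ 1 k (reach-edge y z (trans (undirected y z) e)) (reach-sym k x z r′)

    reach-comm : ∀ k x y → reach G k x y ≡ reach G k y x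
    reach-comm k x y with reach G k x y in xy | reach G k y x in yx
    ... | true  | true  = refl
    ... | false | false = refl
    ... | true  | false = trans (sym (reach-sym k x y xy)) yx
    ... | false | true  = trans (sym xy) (reach-sym k y x yx)

    dist-comm : ∀ x y → dist G x y ≡ dist G y x
    dist-comm x y = search n 0
      where
      search : ∀ fuel start → distAux G x y fuel start ≡ distAux G y x fuel start
      search zero       start = refl
      search (suc fuel) start rewrite reach-comm start x y = cong (if reach G start y x then start else_) (search fuel (suc start))


-- A closed walk φ 0, φ 1, …, φ (N-1), φ 0 in an undirected graph bounds its distances by those of C_N.
module CycleIn {n} (G : Graph n) (undirected : Undirected G) (N : ℕ) (φ : ℕ → Fin n)
               (φ-next : ∀ {i j} → Next N i j → G (φ i) (φ j) ≡ true) where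

  reach-arc : ∀ t {a b} → a < N → b < N → arc N a b ≡ t → reach G t (φ a) (φ b) ≡ true
  reach-arc zero {a} {b} a<N b<N arc≡0 with a ≟ b
  ... | yes refl = reach-refl G 0 (φ a)
  ... | no  a≢b  = ⊥-elim (<⇒≢ (arc-pos N a b a<N b<N a≢b) (sym arc≡0))
  reach-arc (suc t) {a} {b} a<N b<N arc≡st with next-pred b<N
  ... | b′ , b′<N , nx = reach-step G t (φ a) (φ b′) (φ b)
        (reach-arc t a<N b′<N (next-suc⁻ (subst (Next N (arc N a b′)) arc≡st (arc-next a (<⇒≤ a<N) b′<N nx))))
        (φ-next nx)

  reach-cycDist : ∀ {a b} → a < N → b < N → reach G (cycDist N (arc N a b)) (φ a) (φ b) ≡ true
  reach-cycDist {a} {b} a<N b<N with a ≟ b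
  ... | yes refl rewrite arc-self N a = reach-refl G 0 (φ a)
  ... | no  a≢b  = reach-⊓ G (arc N a b) (N ∸ arc N a b) (reach-arc _ a<N b<N refl)
                     (reach-sym G undirected (N ∸ arc N a b) (φ b) (φ a) (reach-arc _ b<N a<N (arc-flip N a b a<N b<N a≢b)))

-- The Wiener index as a sum over ordered pairs

-- Saturating conversion ℕ → Fin (suc k), used to index vertices by natural numbers.
clamp : (k : ℕ) → ℕ → Fin (suc k)
clamp zero    _       = Fin.zero
clamp (suc k) zero    = Fin.zero
clamp (suc k) (suc a) = Fin.suc (clamp k a)

toℕ-clamp : ∀ k a → a ≤ k → toℕ (clamp k a) ≡ a
toℕ-clamp zero    zero    _         = refl
toℕ-clamp (suc k) zero    _         = refl
toℕ-clamp (suc k) (suc a) (s≤s a≤k) = cong suc (toℕ-clamp k a a≤k)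

clamp-toℕ : ∀ k (x : Fin (suc k)) → clamp k (toℕ x) ≡ x
clamp-toℕ zero    Fin.zero    = refl
clamp-toℕ (suc k) Fin.zero    = refl
clamp-toℕ (suc k) (Fin.suc x) = cong Fin.suc (clamp-toℕ k x)

sum-tabulate : ∀ k (h : Fin (suc k) → ℕ) → sum (tabulate h) ≡ ∑ (suc k) (h ∘ clamp k)
sum-tabulate zero    h = refl
sum-tabulate (suc k) h = cong (h Fin.zero +_) (sum-tabulate k (h ∘ Fin.suc))

sum-map-allFin : ∀ k (f : Fin (suc k) → ℕ) → sum (map f (allFin (suc k))) ≡ ∑ (suc k) (f ∘ clamp k)
sum-map-allFin k f = trans (cong sum (map-tabulate (λ x → x) f)) (sum-tabulate k f)

sum-concatMap : ∀ {A : Set} (F : A → List ℕ) xs → sum (concatMap F xs) ≡ sum (map (sum ∘ F) xs)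
sum-concatMap F []       = refl
sum-concatMap F (x ∷ xs) = trans (sum-++ (F x) _) (cong (sum (F x) +_) (sum-concatMap F xs))

sum-map-filter : ∀ {A : Set} {P : Pred A 0ℓ} (P? : Decidable P) (d : A → ℕ) xs →
                 sum (map d (filter P? xs)) ≡ sum (map (λ y → if does (P? y) then d y else 0) xs)
sum-map-filter P? d []       = refl
sum-map-filter P? d (x ∷ xs) with does (P? x)
... | true  = cong (d x +_) (sum-map-filter P? d xs)
... | false = sum-map-filter P? d xs

ifLt : ℕ → ℕ → ℕ → ℕ
ifLt a b v = if a <ᵇ b then v else 0

sum-upper-pairs : ∀ k (f : Fin (suc k) → Fin (suc k) → ℕ) →
  sum (concatMap (λ x → map (f x) (filter (λ y → toℕ x <? toℕ y) (allFin (suc k)))) (allFin (suc k)))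
  ≡ ∑ (suc k) (λ a → ∑ (suc k) (λ b → ifLt a b (f (clamp k a) (clamp k b))))
sum-upper-pairs k f = begin
  sum (concatMap row (allFin n))                                         ≡⟨ sum-concatMap row (allFin n) ⟩
  sum (map (sum ∘ row) (allFin n))                                       ≡⟨ cong sum (map-cong filtered (allFin n)) ⟩
  sum (map (λ x → sum (map (masked x) (allFin n))) (allFin n))           ≡⟨ sum-map-allFin k (λ x → sum (map (masked x) (allFin n))) ⟩
  ∑ n (λ a → sum (map (masked (clamp k a)) (allFin n)))                  ≡⟨ ∑-cong n (λ a _ → sum-map-allFin k (masked (clamp k a))) ⟩
  ∑ n (λ a → ∑ n (λ b → masked (clamp k a) (clamp k b)))                 ≡⟨ ∑-cong n (λ a a<n → ∑-cong n (λ b b<n →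
                                                                             cong₂ (λ u v → ifLt u v (f (clamp k a) (clamp k b)))
                                                                               (toℕ-clamp k a (≤-pred a<n)) (toℕ-clamp k b (≤-pred b<n)))) ⟩
  ∑ n (λ a → ∑ n (λ b → ifLt a b (f (clamp k a) (clamp k b))))           ∎
  where
  open ≡-Reasoning
  n = suc k
  row : Fin n → List ℕ
  row x = map (f x) (filter (λ y → toℕ x <? toℕ y) (allFin n))
  masked : Fin n → Fin n → ℕ
  masked x y = ifLt (toℕ x) (toℕ y) (f x y)
  filtered : ∀ x → sum (row x) ≡ sum (map (masked x) (allFin n))
  filtered x = sum-map-filter (λ y → toℕ x <? toℕ y) (f x) (allFin n)

∑∑-symmetric : ∀ n (f : ℕ → ℕ → ℕ) → (∀ a b → a < n → b < n → f a b ≡ f b a) → (∀ a → a < n → f a a ≡ 0) →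
               ∑ n (λ a → ∑ n (f a)) ≡ 2 * ∑ n (λ a → ∑ n (λ b → ifLt a b (f a b)))
∑∑-symmetric n f symmetric diagonal = begin
  ∑ n (λ a → ∑ n (f a))                                          ≡⟨ ∑-cong n (λ a a<n → ∑-cong n (λ b b<n → split a b a<n b<n)) ⟩
  ∑ n (λ a → ∑ n (λ b → upper a b + upper b a))                  ≡⟨ ∑-cong n (λ a _ → ∑-distrib-+ n (upper a) (λ b → upper b a)) ⟩
  ∑ n (λ a → ∑ n (upper a) + ∑ n (λ b → upper b a))              ≡⟨ ∑-distrib-+ n _ _ ⟩
  X + ∑ n (λ a → ∑ n (λ b → upper b a))                          ≡⟨ cong (X +_) (∑-comm n n (λ a b → upper b a)) ⟩
  X + X                                                          ≡⟨ cong (X +_) (+-identityʳ X) ⟨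
  2 * X                                                          ∎
  where
  open ≡-Reasoning
  upper : ℕ → ℕ → ℕ
  upper a b = ifLt a b (f a b)
  X = ∑ n (λ a → ∑ n (upper a))
  split : ∀ a b → a < n → b < n → f a b ≡ upper a b + upper b a
  split a b a<n b<n with <-cmp a b
  ... | tri< a<b _ _ rewrite <ᵇ-true⁺ a<b | <ᵇ-false⁺ (<⇒≤ a<b) = sym (+-identityʳ (f a b))
  ... | tri≈ _ refl _ rewrite <ᵇ-false⁺ (≤-refl {a}) = diagonal a a<n
  ... | tri> _ _ b<a rewrite <ᵇ-true⁺ b<a | <ᵇ-false⁺ (<⇒≤ b<a) = symmetric a b a<n b<n

distℕ : ∀ {k} → Graph (suc k) → ℕ → ℕ → ℕ
distℕ {k} G a b = dist G (clamp k a) (clamp k b)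

2*wiener : ∀ {k} (G : Graph (suc k)) → Undirected G → 2 * wiener G ≡ ∑ (suc k) (λ a → ∑ (suc k) (distℕ G a))
2*wiener {k} G undirected = sym (trans
  (∑∑-symmetric (suc k) (distℕ G) (λ a b _ _ → dist-comm G undirected (clamp k a) (clamp k b)) (λ a _ → dist-self G (clamp k a)))
  (cong (2 *_) (sym (sum-upper-pairs k (dist G)))))

-- A lower bound for W(C_{n,3})

Cn3-undirected : ∀ m → Undirected (Cn3 (suc (suc m)))
Cn3-undirected m i j =
  cong₂ _∨_ (trans (cong (λ z → (a <ᵇ m) ∧ ((b <ᵇ m) ∧ z)) (cycAdj-comm m a b)) (∧-swap (a <ᵇ m) (b <ᵇ m) _))
  (cong₂ _∨_ (samePair-comm a b 0 m) (cong₂ _∨_ (samePair-comm a b 0 (suc m)) (samePair-comm a b m (suc m))))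
  where a = toℕ i
        b = toℕ j

data Cn3Edge (m : ℕ) : ℕ → ℕ → Set where
  rim   : ∀ {a b} → a < m → Next m a b → Cn3Edge m a b
  spoke : ∀ {x} → m ≤ x → Cn3Edge m 0 x
  tips  : Cn3Edge m m (suc m)
  flip  : ∀ {a b} → Cn3Edge m a b → Cn3Edge m b a

spoke-pair : ∀ {m a b x} → m ≤ x → (a ≡ 0 × b ≡ x) ⊎ (a ≡ x × b ≡ 0) → Cn3Edge m a b
spoke-pair m≤x (inj₁ (refl , refl)) = spoke m≤x
spoke-pair m≤x (inj₂ (refl , refl)) = flip (spoke m≤x)

tips-pair : ∀ {m a b} → (a ≡ m × b ≡ suc m) ⊎ (a ≡ suc m × b ≡ m) → Cn3Edge m a b
tips-pair (inj₁ (refl , refl)) = tips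
tips-pair (inj₂ (refl , refl)) = flip tips

rim-pair : ∀ {m a b} → a < m → b < m → Next m a b ⊎ Next m b a → Cn3Edge m a b
rim-pair a<m b<m (inj₁ nx) = rim a<m nx
rim-pair a<m b<m (inj₂ nx) = flip (rim b<m nx)

Cn3⁻ : ∀ m (i j : Fin (suc (suc m))) → Cn3 (suc (suc m)) i j ≡ true → Cn3Edge m (toℕ i) (toℕ j)
Cn3⁻ m i j e with ∨-true⁻ ((a <ᵇ m) ∧ ((b <ᵇ m) ∧ cycAdjℕ m a b)) e
  where a = toℕ i
        b = toℕ j
... | inj₁ onRim =
  let a<ᵇm , onRim′ = ∧-true⁻ (toℕ i <ᵇ m) onRim
      b<ᵇm , adj    = ∧-true⁻ (toℕ j <ᵇ m) onRim′
      a<m = <ᵇ-true⁻ _ m a<ᵇm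
      b<m = <ᵇ-true⁻ _ m b<ᵇm
  in rim-pair a<m b<m (cycAdj⁻ m _ _ a<m b<m adj)
... | inj₂ rest with ∨-true⁻ (samePair (toℕ i) (toℕ j) 0 m) rest
...   | inj₁ sp = spoke-pair ≤-refl (samePair⁻ _ _ 0 m sp)
...   | inj₂ rest′ with ∨-true⁻ (samePair (toℕ i) (toℕ j) 0 (suc m)) rest′
...     | inj₁ sp = spoke-pair (n≤1+n m) (samePair⁻ _ _ 0 (suc m) sp)
...     | inj₂ sp = tips-pair (samePair⁻ _ _ m (suc m) sp)

-- The distance between a and b in C_{m+2,3} (only the bound cn3Dist ≤ dist is proved and needed).
cn3Dist : ℕ → ℕ → ℕ → ℕ
cn3Dist m a b =
  if a <ᵇ m then (if b <ᵇ m then cycDist m (arc m a b) else suc (cycDist m a))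
            else (if b <ᵇ m then suc (cycDist m b) else (if a ≡ᵇ b then 0 else 1))

module _ {m a b : ℕ} where

  cn3Dist-rim-rim : a < m → b < m → cn3Dist m a b ≡ cycDist m (arc m a b)
  cn3Dist-rim-rim a<m b<m rewrite <ᵇ-true⁺ a<m | <ᵇ-true⁺ b<m = refl

  cn3Dist-rim-tip : a < m → m ≤ b → cn3Dist m a b ≡ suc (cycDist m a)
  cn3Dist-rim-tip a<m m≤b rewrite <ᵇ-true⁺ a<m | <ᵇ-false⁺ m≤b = refl

  cn3Dist-tip-rim : m ≤ a → b < m → cn3Dist m a b ≡ suc (cycDist m b)
  cn3Dist-tip-rim m≤a b<m rewrite <ᵇ-false⁺ m≤a | <ᵇ-true⁺ b<m = refl

  cn3Dist-tip-tip : m ≤ a → m ≤ b → cn3Dist m a b ≡ (if a ≡ᵇ b then 0 else 1)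
  cn3Dist-tip-tip m≤a m≤b rewrite <ᵇ-false⁺ m≤a | <ᵇ-false⁺ m≤b = refl

  cn3Dist-tip-tip-≤ : m ≤ a → m ≤ b → cn3Dist m a b ≤ 1
  cn3Dist-tip-tip-≤ m≤a m≤b rewrite cn3Dist-tip-tip m≤a m≤b with a ≡ᵇ b
  ... | true  = z≤n
  ... | false = ≤-refl

cn3Dist-self : ∀ m a → cn3Dist m a a ≡ 0
cn3Dist-self m a with a <? m
... | yes a<m rewrite cn3Dist-rim-rim a<m a<m | arc-self m a = refl
... | no  a≮m rewrite cn3Dist-tip-tip (≮⇒≥ a≮m) (≮⇒≥ a≮m) | ≡ᵇ-refl a = refl

cn3Dist≤ : ∀ m a b → cn3Dist m a b ≤ suc (suc m)
cn3Dist≤ m a b with a <? m | b <? m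
... | yes a<m | yes b<m rewrite cn3Dist-rim-rim a<m b<m = ≤-trans (cycDist≤ m _) (m≤n+m m 2)
... | yes a<m | no  b≮m rewrite cn3Dist-rim-tip a<m (≮⇒≥ b≮m) = s≤s (m≤n⇒m≤1+n (cycDist≤ m a))
... | no  a≮m | yes b<m rewrite cn3Dist-tip-rim (≮⇒≥ a≮m) b<m = s≤s (m≤n⇒m≤1+n (cycDist≤ m b))
... | no  a≮m | no  b≮m = ≤-trans (cn3Dist-tip-tip-≤ (≮⇒≥ a≮m) (≮⇒≥ b≮m)) (s≤s z≤n)

Close : ℕ → ℕ → Set
Close u v = u ≤ suc v × v ≤ suc u

close-sym : ∀ {u v} → Close u v → Close v u
close-sym (u≤ , v≤) = v≤ , u≤

cn3Dist-close : ∀ m c {a b} → 0 < m → Cn3Edge m a b → Close (cn3Dist m c a) (cn3Dist m c b)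
cn3Dist-close m c 0<m (flip e) = close-sym (cn3Dist-close m c 0<m e)
cn3Dist-close m c {a} {b} 0<m (rim a<m nx) with c <? m
... | yes c<m rewrite cn3Dist-rim-rim c<m a<m | cn3Dist-rim-rim c<m (next-target< a<m nx) =
  cycDist-prev-≤ (arc-next c (<⇒≤ c<m) a<m nx) , cycDist-next-≤ (arc-next c (<⇒≤ c<m) a<m nx)
... | no  c≮m rewrite cn3Dist-tip-rim (≮⇒≥ c≮m) a<m | cn3Dist-tip-rim (≮⇒≥ c≮m) (next-target< a<m nx) =
  s≤s (cycDist-prev-≤ nx) , s≤s (cycDist-next-≤ nx)
cn3Dist-close m c 0<m (spoke m≤x) with c <? m
... | yes c<m rewrite cn3Dist-rim-rim c<m 0<m | cn3Dist-rim-tip c<m m≤x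
                    | cycDist-arc-comm m c 0 c<m 0<m | arc-zero m c = m≤n+m _ 2 , ≤-refl
... | no  c≮m rewrite cn3Dist-tip-rim (≮⇒≥ c≮m) 0<m =
  s≤s z≤n , ≤-trans (cn3Dist-tip-tip-≤ (≮⇒≥ c≮m) m≤x) (s≤s z≤n)
cn3Dist-close m c 0<m tips with c <? m
... | yes c<m rewrite cn3Dist-rim-tip c<m (≤-refl {m}) | cn3Dist-rim-tip c<m (n≤1+n m) = n≤1+n _ , n≤1+n _
... | no  c≮m = ≤-trans (cn3Dist-tip-tip-≤ (≮⇒≥ c≮m) ≤-refl) (s≤s z≤n)
              , ≤-trans (cn3Dist-tip-tip-≤ (≮⇒≥ c≮m) (n≤1+n m)) (s≤s z≤n)

cn3Dist≤distℕ : ∀ m a b → 0 < m → a < suc (suc m) → b < suc (suc m) →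
                cn3Dist m a b ≤ distℕ (Cn3 (suc (suc m))) a b
cn3Dist≤distℕ m a b 0<m a<n b<n =
  subst (_≤ distℕ (Cn3 n) a b) (cong (cn3Dist m a) (toℕ-clamp (suc m) b (≤-pred b<n)))
    (potential≤dist (Cn3 n) (clamp (suc m) a) (λ y → cn3Dist m a (toℕ y))
      (trans (cong (cn3Dist m a) (toℕ-clamp (suc m) a (≤-pred a<n))) (cn3Dist-self m a))
      (λ z y e → proj₂ (cn3Dist-close m a 0<m (Cn3⁻ m z y e)))
      (clamp (suc m) b) (cn3Dist≤ m a _))
  where n = suc (suc m)

cn3Dist-row-rim : ∀ m c → c < m → ∑ (suc (suc m)) (cn3Dist m c) ≡ status m + suc (cycDist m c) + suc (cycDist m c)
cn3Dist-row-rim m c c<m = begin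
  ∑ (suc (suc m)) (cn3Dist m c)                            ≡⟨ ∑-suc-suc m (cn3Dist m c) ⟩
  ∑ m (cn3Dist m c) + cn3Dist m c m + cn3Dist m c (suc m)  ≡⟨ cong₂ _+_ (cong₂ _+_ rimPart
                                                                 (cn3Dist-rim-tip c<m ≤-refl)) (cn3Dist-rim-tip c<m (n≤1+n m)) ⟩
  status m + suc (cycDist m c) + suc (cycDist m c)         ∎
  where
  open ≡-Reasoning
  rimPart : ∑ m (cn3Dist m c) ≡ status m
  rimPart = trans (∑-cong m (λ b b<m → cn3Dist-rim-rim c<m b<m)) (∑-rotate m c (cycDist m) (<⇒≤ c<m))

cn3Dist-row-tip : ∀ m c → c ≡ m ⊎ c ≡ suc m → ∑ (suc (suc m)) (cn3Dist m c) ≡ m + status m + 1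
cn3Dist-row-tip m c tip = begin
  ∑ (suc (suc m)) (cn3Dist m c)                            ≡⟨ ∑-suc-suc m (cn3Dist m c) ⟩
  ∑ m (cn3Dist m c) + cn3Dist m c m + cn3Dist m c (suc m)  ≡⟨ +-assoc (∑ m (cn3Dist m c)) _ _ ⟩
  ∑ m (cn3Dist m c) + (cn3Dist m c m + cn3Dist m c (suc m)) ≡⟨ cong₂ _+_ rimPart (tipPart tip) ⟩
  m + status m + 1                                         ∎
  where
  open ≡-Reasoning
  tip≥ : c ≡ m ⊎ c ≡ suc m → m ≤ c
  tip≥ (inj₁ refl) = ≤-refl
  tip≥ (inj₂ refl) = n≤1+n m
  m≤c = tip≥ tip
  rimPart : ∑ m (cn3Dist m c) ≡ m + status m
  rimPart = trans (∑-cong m (λ b b<m → cn3Dist-tip-rim m≤c b<m)) (∑-suc m (cycDist m))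
  tipPart : c ≡ m ⊎ c ≡ suc m → cn3Dist m c m + cn3Dist m c (suc m) ≡ 1
  tipPart (inj₁ refl) rewrite cn3Dist-tip-tip (≤-refl {m}) (≤-refl {m}) | cn3Dist-tip-tip (≤-refl {m}) (n≤1+n m)
                            | ≡ᵇ-refl m | ≡ᵇ-false⁺ m (suc m) (1+n≢n ∘ sym) = refl
  tipPart (inj₂ refl) rewrite cn3Dist-tip-tip (n≤1+n m) (≤-refl {m}) | cn3Dist-tip-tip (n≤1+n m) (n≤1+n m)
                            | ≡ᵇ-refl (suc m) | ≡ᵇ-false⁺ (suc m) m 1+n≢n = refl

cn3Dist-total : ∀ m → ∑ (suc (suc m)) (λ c → ∑ (suc (suc m)) (cn3Dist m c)) ≡ (m + 4) * status m + 4 * m + 2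
cn3Dist-total m = begin
  ∑ (suc (suc m)) (λ c → ∑ (suc (suc m)) (cn3Dist m c))     ≡⟨ ∑-suc-suc m _ ⟩
  ∑ m (λ c → ∑ (suc (suc m)) (cn3Dist m c)) + row m + row (suc m)
      ≡⟨ cong₂ _+_ (cong₂ _+_ (∑-cong m (λ c c<m → cn3Dist-row-rim m c c<m)) (cn3Dist-row-tip m m (inj₁ refl)))
                   (cn3Dist-row-tip m (suc m) (inj₂ refl)) ⟩
  ∑ m (λ c → status m + suc (cycDist m c) + suc (cycDist m c)) + (m + status m + 1) + (m + status m + 1)
      ≡⟨ cong (λ z → z + (m + status m + 1) + (m + status m + 1)) rimRows ⟩
  m * status m + (m + status m) + (m + status m) + (m + status m + 1) + (m + status m + 1)
      ≡⟨ collect m (status m) ⟩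
  (m + 4) * status m + 4 * m + 2                            ∎
  where
  open ≡-Reasoning
  row : ℕ → ℕ
  row c = ∑ (suc (suc m)) (cn3Dist m c)
  rimRows : ∑ m (λ c → status m + suc (cycDist m c) + suc (cycDist m c)) ≡ m * status m + (m + status m) + (m + status m)
  rimRows = trans (∑-distrib-+ m _ _) (cong₂ _+_ (trans (∑-distrib-+ m _ _)
              (cong₂ _+_ (∑-const m (status m)) (∑-suc m (cycDist m)))) (∑-suc m (cycDist m)))
  collect : ∀ m r → m * r + (m + r) + (m + r) + (m + r + 1) + (m + r + 1) ≡ (m + 4) * r + 4 * m + 2
  collect = solve-∀

wiener-Cn3-≥ : ∀ m → 0 < m → (m + 4) * status m + 4 * m + 2 ≤ 2 * wiener (Cn3 (suc (suc m)))
wiener-Cn3-≥ m 0<m = begin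
  (m + 4) * status m + 4 * m + 2               ≡⟨ cn3Dist-total m ⟨
  ∑ n (λ a → ∑ n (cn3Dist m a))               ≤⟨ ∑-mono-≤ n (λ a a<n → ∑-mono-≤ n (λ b b<n → cn3Dist≤distℕ m a b 0<m a<n b<n)) ⟩
  ∑ n (λ a → ∑ n (distℕ (Cn3 n) a))           ≡⟨ 2*wiener (Cn3 n) (Cn3-undirected m) ⟨
  2 * wiener (Cn3 n)                           ∎
  where
  open ≤-Reasoning
  n = suc (suc m)

-- An upper bound for C_n plus a balanced chord

module Chord {k} (G : Graph (suc k)) (undirected : Undirected G)
             (cycle⊆G : ∀ i j → cycleGraph (suc k) i j ≡ true → G i j ≡ true)
             {p q} (p<n : p < suc k) (q<n : q < suc k) (chord : G (clamp k p) (clamp k q) ≡ true) where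

  private
    n = suc k
    c = arc n p q
    c<n : c < n
    c<n = arc<N n p q (<⇒≤ p<n) q<n

  vertexAt : ℕ → Fin n
  vertexAt i = clamp k (arc n (n ∸ p) i)

  vertexAt-arc : ∀ {x} → x < n → vertexAt (arc n p x) ≡ clamp k x
  vertexAt-arc x<n = cong (clamp k) (arc-inverse n p _ p<n x<n)

  cycle-edge : ∀ {x y} → x < n → y < n → cycAdjℕ n x y ≡ true → G (clamp k x) (clamp k y) ≡ true
  cycle-edge {x} {y} x<n y<n adj =
    cycle⊆G _ _ (subst₂ (λ u v → cycAdjℕ n u v ≡ true) (sym (toℕ-clamp k x (≤-pred x<n))) (sym (toℕ-clamp k y (≤-pred y<n))) adj)

  vertexAt-next : ∀ {i j} → Next (suc c) i j → G (vertexAt i) (vertexAt j) ≡ true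
  vertexAt-next {i} (next-step si<sc) =
    cycle-edge (arc<N n _ i (m∸n≤m n p) i<n) (arc<N n _ (suc i) (m∸n≤m n p) si<n)
      (cycAdj⁺ (arc-next (n ∸ p) (m∸n≤m n p) i<n (next-step si<n)))
    where si<n = <-≤-trans si<sc c<n
          i<n  = <-trans (n<1+n i) si<n
  vertexAt-next (next-wrap refl) = begin
    G (vertexAt c) (vertexAt 0)                ≡⟨ cong₂ G (vertexAt-arc q<n) (trans (cong vertexAt (sym (arc-self n p))) (vertexAt-arc p<n)) ⟩
    G (clamp k q) (clamp k p)                  ≡⟨ undirected _ _ ⟩
    G (clamp k p) (clamp k q)                  ≡⟨ chord ⟩
    true                                       ∎
    where open ≡-Reasoning

  open CycleIn G undirected (suc c) vertexAt vertexAt-next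

  reach-side : ∀ {x y} → x < n → y < n → arc n p x ≤ c → arc n p y ≤ c →
               reach G (cycDist (suc c) (arc (suc c) (arc n p x) (arc n p y))) (clamp k x) (clamp k y) ≡ true
  reach-side {x} {y} x<n y<n x≤c y≤c =
    subst₂ (λ u v → reach G (cycDist (suc c) (arc (suc c) (arc n p x) (arc n p y))) u v ≡ true) (vertexAt-arc x<n) (vertexAt-arc y<n) (reach-cycDist (s≤s x≤c) (s≤s y≤c))

-- Bound on the distance from the vertex at offset a ≤ c to the vertex at offset b from one end of a
-- chord spanning offsets 0 and c in C_n + chord: inside the cycle closed by the chord, or else
-- through the chord end nearer to a and then along the other cycle.
chordBound : ℕ → ℕ → ℕ → ℕ → ℕ
chordBound n c a b =
  if b ≤ᵇ c then cycDist (suc c) (arc (suc c) a b)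
  else cycDist c a + cycDist (suc (n ∸ c)) (arc (suc (n ∸ c)) (if 2 * a ≤ᵇ c then n ∸ c else 0) (arc n c b))

chordBound-inside : ∀ n c a b → b ≤ c → chordBound n c a b ≡ cycDist (suc c) (arc (suc c) a b)
chordBound-inside n c a b b≤c rewrite ≤ᵇ-true⁺ b≤c = refl

chordBound-outside : ∀ n c a b → c < b →
  chordBound n c a b ≡ cycDist c a + cycDist (suc (n ∸ c)) (arc (suc (n ∸ c)) (if 2 * a ≤ᵇ c then n ∸ c else 0) (arc n c b))
chordBound-outside n c a b c<b rewrite ≤ᵇ-false⁺ c<b = refl

nearer-end : ∀ (P : ℕ → Set) c a {u v} → (2 * a ≤ c → P u) → (c < 2 * a → P v) → P (if 2 * a ≤ᵇ c then u else v)
nearer-end P c a near far with 2 * a ≤ᵇ c in eq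
... | true  = near (≤ᵇ⇒≤ (2 * a) c (≡true⇒T eq))
... | false = far (≰⇒> λ 2a≤c → case (trans (sym (≤ᵇ-true⁺ 2a≤c)) eq))
  where case : true ≡ false → _
        case ()

module _ {k} (G : Graph (suc k)) (undirected : Undirected G)
         (cycle⊆G : ∀ i j → cycleGraph (suc k) i j ≡ true → G i j ≡ true)
         {p q} (p<n : p < suc k) (q<n : q < suc k) (p≢q : p ≢ q) (chord : G (clamp k p) (clamp k q) ≡ true) where

  private
    n = suc k
    c = arc n p q
    d = arc n q p
    module Side₁ = Chord G undirected cycle⊆G p<n q<n chord
    module Side₂ = Chord G undirected cycle⊆G q<n p<n (trans (undirected _ _) chord)

  module _ {x y} (x<n : x < n) (y<n : y < n) (a≤c : arc n p x ≤ c) (c<b : c < arc n p y) where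

    private
      a = arc n p x
      y-beyond = arc-beyond n p q y p<n q<n y<n p≢q c<b

    reach-via-p : 2 * a ≤ c → reach G (cycDist c a + cycDist (suc d) (arc (suc d) d (arc n q y))) (clamp k x) (clamp k y) ≡ true
    reach-via-p near = reach-++ G (cycDist c a) _
      (reach-mono G _ _ _ toP (Side₁.reach-side x<n p<n a≤c (subst (_≤ c) (sym (arc-self n p)) z≤n)))
      (Side₂.reach-side p<n y<n ≤-refl y-beyond)
      where
      toP : cycDist (suc c) (arc (suc c) a (arc n p p)) ≤ cycDist c a
      toP rewrite arc-self n p | cycDist-near c a near = cycDist-arc-to-0 (suc c) (s≤s a≤c)

    reach-via-q : c < 2 * a → reach G (cycDist c a + cycDist (suc d) (arc (suc d) 0 (arc n q y))) (clamp k x) (clamp k y) ≡ true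
    reach-via-q far = reach-++ G (cycDist c a) _
      (reach-mono G _ _ _ toQ (Side₁.reach-side x<n q<n a≤c ≤-refl))
      (subst (λ e → reach G (cycDist (suc d) (arc (suc d) e (arc n q y))) (clamp k q) (clamp k y) ≡ true) (arc-self n q)
        (Side₂.reach-side q<n y<n (subst (_≤ d) (sym (arc-self n q)) z≤n) y-beyond))
      where
      toQ : cycDist (suc c) (arc (suc c) a (arc n p q)) ≤ cycDist c a
      toQ rewrite cycDist-far c a far = cycDist-arc-≤ (suc c) a≤c

  reach-chordBound : ∀ {x y} → x < n → y < n → arc n p x ≤ c →
                     reach G (chordBound n c (arc n p x) (arc n p y)) (clamp k x) (clamp k y) ≡ true
  reach-chordBound {x} {y} x<n y<n a≤c = Sum.[ inside , outside ]′ (≤-<-connex b c)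
    where
    a = arc n p x
    b = arc n p y
    inside : b ≤ c → reach G (chordBound n c a b) (clamp k x) (clamp k y) ≡ true
    inside b≤c = subst (λ t → reach G t (clamp k x) (clamp k y) ≡ true) (sym (chordBound-inside n c a b b≤c))
                   (Side₁.reach-side x<n y<n a≤c b≤c)
    outside : c < b → reach G (chordBound n c a b) (clamp k x) (clamp k y) ≡ true
    outside c<b = subst (λ t → reach G t (clamp k x) (clamp k y) ≡ true) (sym from-q)
                    (nearer-end (λ e → reach G (cycDist c a + cycDist (suc d) (arc (suc d) e (arc n q y))) (clamp k x) (clamp k y) ≡ true)
                      c a (reach-via-p x<n y<n a≤c c<b) (reach-via-q x<n y<n a≤c c<b))
      where
      from-q : chordBound n c a b ≡ cycDist c a + cycDist (suc d) (arc (suc d) (if 2 * a ≤ᵇ c then d else 0) (arc n q y))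
      from-q = trans (chordBound-outside n c a b c<b)
        (cong₂ (λ d′ t → cycDist c a + cycDist (suc d′) (arc (suc d′) (if 2 * a ≤ᵇ c then d′ else 0) t))
               (sym (arc-flip n p q p<n q<n p≢q)) (arc-trans n p q y p<n q<n y<n))

chordBound-row : ∀ {n} M c a → n ≡ suc c + M → a ≤ c →
  ∑ n (chordBound n c a) + 1 ≡ status (suc c) + M * cycDist c a + status (suc (suc M))
chordBound-row M c a refl a≤c = begin
  ∑ (suc c + M) row + 1                                          ≡⟨ cong (_+ 1) (∑-split (suc c) M row) ⟩
  ∑ (suc c) row + ∑ M (λ i → row (suc c + i)) + 1                ≡⟨ cong₂ (λ u v → u + v + 1) inner (∑-cong M (λ i _ → outer i)) ⟩
  status (suc c) + ∑ M (λ i → cycDist c a + h i) + 1             ≡⟨ cong (λ z → status (suc c) + z + 1) (∑-distrib-+ M _ h) ⟩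
  status (suc c) + (∑ M (λ _ → cycDist c a) + ∑ M h) + 1         ≡⟨ cong (λ z → status (suc c) + (z + ∑ M h) + 1) (∑-const M _) ⟩
  status (suc c) + (M * cycDist c a + ∑ M h) + 1                 ≡⟨ regroup (status (suc c)) (M * cycDist c a) (∑ M h) ⟩
  status (suc c) + M * cycDist c a + (∑ M h + 1)                 ≡⟨ cong (status (suc c) + M * cycDist c a +_) (status-interior M e exit) ⟩
  status (suc c) + M * cycDist c a + status (suc (suc M))        ∎
  where
  open ≡-Reasoning
  row = chordBound (suc c + M) c a
  e = if 2 * a ≤ᵇ c then suc M else 0
  h : ℕ → ℕ
  h i = cycDist (suc (suc M)) (arc (suc (suc M)) e (suc i))
  exit : e ≡ 0 ⊎ e ≡ suc M
  exit with 2 * a ≤ᵇ c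
  ... | true  = inj₂ refl
  ... | false = inj₁ refl
  inner : ∑ (suc c) row ≡ status (suc c)
  inner = trans (∑-cong (suc c) (λ b b<sc → chordBound-inside (suc c + M) c a b (≤-pred b<sc)))
                (∑-rotate (suc c) a (cycDist (suc c)) (m≤n⇒m≤1+n a≤c))
  other-side : suc c + M ∸ c ≡ suc M
  other-side = trans (cong (_∸ c) (sym (+-suc c M))) (m+n∸m≡n c (suc M))
  outer : ∀ i → row (suc c + i) ≡ cycDist c a + h i
  outer i rewrite ≤ᵇ-false⁺ {suc c + i} {c} (s≤s (m≤m+n c i)) | other-side | arc-offset (suc c + M) c i = refl
  regroup : ∀ x y z → x + (y + z) + 1 ≡ x + y + (z + 1)
  regroup = solve-∀

-- Offsets are measured from p; the chord {p, q} spans offsets 0 and c, and vertices beyond offset c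
-- are measured from q on the complementary cycle.
pairBound : ℕ → ℕ → ℕ → ℕ → ℕ
pairBound n c a b = if a ≤ᵇ c then chordBound n c a b else chordBound n (n ∸ c) (arc n c a) (arc n c b)

pairBound-near : ∀ n c a b → a ≤ c → pairBound n c a b ≡ chordBound n c a b
pairBound-near n c a b a≤c rewrite ≤ᵇ-true⁺ a≤c = refl

pairBound-far : ∀ n c a b → c < a → pairBound n c a b ≡ chordBound n (n ∸ c) (arc n c a) (arc n c b)
pairBound-far n c a b c<a rewrite ≤ᵇ-false⁺ c<a = refl

pairBound-row-near : ∀ {n} c′ d′ a → n ≡ suc c′ + suc d′ → a ≤ suc c′ →
  ∑ n (pairBound n (suc c′) a) + 1 ≡ status (2 + c′) + d′ * cycDist (suc c′) a + status (2 + d′)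
pairBound-row-near {n} c′ d′ a n≡ a≤c =
  trans (cong (_+ 1) (∑-cong n (λ b _ → pairBound-near n (suc c′) a b a≤c)))
        (chordBound-row d′ (suc c′) a (trans n≡ (+-suc (suc c′) d′)) a≤c)

pairBound-row-far : ∀ {n} c′ d′ i → n ≡ suc c′ + suc d′ → i < d′ →
  ∑ n (pairBound n (suc c′) (2 + c′ + i)) + 1 ≡ status (2 + d′) + c′ * cycDist (suc d′) (suc i) + status (2 + c′)
pairBound-row-far c′ d′ i refl i<d′ = begin
  ∑ n (pairBound n c (suc c + i)) + 1                                    ≡⟨ cong (_+ 1) (∑-cong n (λ b _ →
                                                                              pairBound-far n c (suc c + i) b (s≤s (m≤m+n c i)))) ⟩
  ∑ n (λ b → chordBound n (n ∸ c) (arc n c (suc c + i)) (arc n c b)) + 1 ≡⟨ cong₂ (λ u v → ∑ n (λ b → chordBound n u v (arc n c b)) + 1)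
                                                                              (m+n∸m≡n c d) (arc-offset n c i) ⟩
  ∑ n (λ b → chordBound n d (suc i) (arc n c b)) + 1                     ≡⟨ cong (_+ 1) (∑-rotate n c (chordBound n d (suc i)) (m≤m+n c d)) ⟩
  ∑ n (chordBound n d (suc i)) + 1                                       ≡⟨ chordBound-row c′ d (suc i) (swap c′ d′) (s≤s (<⇒≤ i<d′)) ⟩
  status (suc d) + c′ * cycDist d (suc i) + status (suc c)               ∎
  where
  open ≡-Reasoning
  c = suc c′
  d = suc d′
  n = c + d
  swap : ∀ c′ d′ → suc c′ + suc d′ ≡ suc (suc d′) + c′
  swap = solve-∀

pairBound-total : ∀ {n} c′ d′ → n ≡ suc c′ + suc d′ →
  ∑ n (λ a → ∑ n (pairBound n (suc c′) a)) + n
  ≡ n * (status (2 + c′) + status (2 + d′)) + d′ * status (suc c′) + c′ * status (suc d′)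
pairBound-total c′ d′ refl = begin
  ∑ n (λ a → ∑ n (pairBound n c a)) + n             ≡⟨ ∑-+1 n (λ a → ∑ n (pairBound n c a)) ⟨
  ∑ n rowSum                                        ≡⟨ cong (λ z → ∑ z rowSum) n≡ ⟩
  ∑ (suc c + d′) rowSum                             ≡⟨ ∑-split (suc c) d′ rowSum ⟩
  ∑ (suc c) rowSum + ∑ d′ (λ i → rowSum (suc c + i))
      ≡⟨ cong₂ _+_ (∑-cong (suc c) (λ a a<sc → pairBound-row-near c′ d′ a refl (≤-pred a<sc)))
                   (∑-cong d′ (λ i i<d′ → pairBound-row-far c′ d′ i refl i<d′)) ⟩
  ∑ (suc c) (λ a → S₁ + d′ * cycDist c a + S₂) + ∑ d′ (λ i → S₂ + c′ * cycDist d (suc i) + S₁)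
      ≡⟨ cong₂ _+_ (∑-affine (suc c) S₁ d′ S₂ (cycDist c)) (∑-affine d′ S₂ c′ S₁ (cycDist d ∘ suc)) ⟩
  suc c * (S₁ + S₂) + d′ * ∑ (suc c) (cycDist c) + (d′ * (S₂ + S₁) + c′ * status d)
      ≡⟨ cong (λ z → suc c * (S₁ + S₂) + d′ * z + (d′ * (S₂ + S₁) + c′ * status d)) (∑-cycDist-closed c) ⟩
  suc c * (S₁ + S₂) + d′ * status c + (d′ * (S₂ + S₁) + c′ * status d)
      ≡⟨ collect (suc c) d′ c′ S₁ S₂ (status c) (status d) ⟩
  (suc c + d′) * (S₁ + S₂) + d′ * status c + c′ * status d
      ≡⟨ cong (λ z → z * (S₁ + S₂) + d′ * status c + c′ * status d) n≡ ⟨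
  n * (S₁ + S₂) + d′ * status c + c′ * status d     ∎
  where
  open ≡-Reasoning
  c = suc c′
  d = suc d′
  n = c + d
  S₁ = status (suc c)
  S₂ = status (suc d)
  rowSum : ℕ → ℕ
  rowSum a = ∑ n (pairBound n c a) + 1
  n≡ : n ≡ suc c + d′
  n≡ = +-suc c d′
  collect : ∀ C D′ C′ S₁ S₂ X Y → C * (S₁ + S₂) + D′ * X + (D′ * (S₂ + S₁) + C′ * Y) ≡ (C + D′) * (S₁ + S₂) + D′ * X + C′ * Y
  collect = solve-∀

module _ {k} (G : Graph (suc k)) (undirected : Undirected G)
         (cycle⊆G : ∀ i j → cycleGraph (suc k) i j ≡ true → G i j ≡ true)
         {p q} (p<n : p < suc k) (q<n : q < suc k) (p≢q : p ≢ q) (chord : G (clamp k p) (clamp k q) ≡ true) where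

  private
    n = suc k
    c = arc n p q

  module _ {x y} (x<n : x < n) (y<n : y < n) where

    reach-near : arc n p x ≤ c → reach G (pairBound n c (arc n p x) (arc n p y)) (clamp k x) (clamp k y) ≡ true
    reach-near a≤c = subst (λ t → reach G t (clamp k x) (clamp k y) ≡ true)
                       (sym (pairBound-near n c (arc n p x) (arc n p y) a≤c))
                       (reach-chordBound G undirected cycle⊆G p<n q<n p≢q chord x<n y<n a≤c)

    reach-far : c < arc n p x → reach G (pairBound n c (arc n p x) (arc n p y)) (clamp k x) (clamp k y) ≡ true
    reach-far c<a = subst (λ t → reach G t (clamp k x) (clamp k y) ≡ true) (sym from-q)
                      (reach-chordBound G undirected cycle⊆G q<n p<n (p≢q ∘ sym) (trans (undirected (clamp k q) (clamp k p)) chord)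
                        x<n y<n (arc-beyond n p q x p<n q<n x<n p≢q c<a))
      where
      from-q : pairBound n c (arc n p x) (arc n p y) ≡ chordBound n (arc n q p) (arc n q x) (arc n q y)
      from-q = begin
        pairBound n c (arc n p x) (arc n p y)                            ≡⟨ pairBound-far n c (arc n p x) (arc n p y) c<a ⟩
        chordBound n (n ∸ c) (arc n c (arc n p x)) (arc n c (arc n p y)) ≡⟨ cong₂ (λ d a → chordBound n d a (arc n c (arc n p y)))
                                                                              (sym (arc-flip n p q p<n q<n p≢q)) (arc-trans n p q x p<n q<n x<n) ⟩
        chordBound n (arc n q p) (arc n q x) (arc n c (arc n p y))       ≡⟨ cong (chordBound n (arc n q p) (arc n q x)) (arc-trans n p q y p<n q<n y<n) ⟩
        chordBound n (arc n q p) (arc n q x) (arc n q y)                 ∎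
        where open ≡-Reasoning

    reach-pairBound : reach G (pairBound n c (arc n p x) (arc n p y)) (clamp k x) (clamp k y) ≡ true
    reach-pairBound = Sum.[ reach-near , reach-far ]′ (≤-<-connex (arc n p x) c)

  2*wiener≤pairBound : 2 * wiener G ≤ ∑ n (λ a → ∑ n (pairBound n c a))
  2*wiener≤pairBound = begin
    2 * wiener G                                                ≡⟨ 2*wiener G undirected ⟩
    ∑ n (λ x → ∑ n (distℕ G x))                                 ≤⟨ ∑-mono-≤ n (λ x x<n → ∑-mono-≤ n (λ y y<n → dist≤pairBound x<n y<n)) ⟩
    ∑ n (λ x → ∑ n (λ y → pairBound n c (arc n p x) (arc n p y))) ≡⟨ ∑-cong n (λ x _ → ∑-rotate n p (pairBound n c (arc n p x)) (<⇒≤ p<n)) ⟩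
    ∑ n (λ x → ∑ n (pairBound n c (arc n p x)))                 ≡⟨ ∑-rotate n p (λ a → ∑ n (pairBound n c a)) (<⇒≤ p<n) ⟩
    ∑ n (λ a → ∑ n (pairBound n c a))                           ∎
    where
    open ≤-Reasoning
    dist≤pairBound : ∀ {x y} → x < n → y < n → distℕ G x y ≤ pairBound n c (arc n p x) (arc n p y)
    dist≤pairBound {x} {y} x<n y<n = dist≤ G _ (clamp k x) (clamp k y) (reach-pairBound x<n y<n)

-- After multiplying by 4 and bounding each status by the square of its argument, what remains is the
-- polynomial fact that σ² + 5σ + (6 + σ) t u exceeds 10 once σ = t + u ≥ 2.
status-inequality : ∀ t u → 2 ≤ t + u →
  (8 + (t + u)) * (status (5 + t) + status (5 + u)) + (3 + u) * status (4 + t) + (3 + t) * status (4 + u)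
  < (10 + (t + u)) * status (6 + (t + u)) + 4 * (6 + (t + u)) + 2 + (8 + (t + u))
status-inequality t u 2≤σ = *-cancelˡ-< 4 _ _ (+-cancelʳ-≤ (10 + σ) (suc (4 * lhs)) (4 * rhs) (begin
  suc (4 * lhs + (10 + σ))   ≤⟨ s≤s (+-monoˡ-≤ (10 + σ) upper) ⟩
  suc (Lp + (10 + σ))        ≤⟨ gap ⟩
  Rp                         ≤⟨ lower ⟩
  4 * rhs + (10 + σ)         ∎))
  where
  open ≤-Reasoning
  σ = t + u
  A₁ = status (5 + t)
  A₂ = status (5 + u)
  P = status (4 + t)
  Q = status (4 + u)
  Z = status (6 + σ)
  lhs = (8 + σ) * (A₁ + A₂) + (3 + u) * P + (3 + t) * Q
  rhs = (10 + σ) * Z + 4 * (6 + σ) + 2 + (8 + σ)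
  Lp = (8 + σ) * ((5 + t) * (5 + t) + (5 + u) * (5 + u)) + (3 + u) * ((4 + t) * (4 + t)) + (3 + t) * ((4 + u) * (4 + u))
  Rp = (10 + σ) * ((6 + σ) * (6 + σ)) + 16 * (6 + σ) + 8 + 4 * (8 + σ)
  upper : 4 * lhs ≤ Lp
  upper = begin
    4 * lhs                                                     ≡⟨ distribute σ t u A₁ A₂ P Q ⟩
    (8 + σ) * (4 * A₁ + 4 * A₂) + (3 + u) * (4 * P) + (3 + t) * (4 * Q)
      ≤⟨ +-mono-≤ (+-mono-≤ (*-monoʳ-≤ (8 + σ) (+-mono-≤ (4*status≤square (5 + t)) (4*status≤square (5 + u))))
                            (*-monoʳ-≤ (3 + u) (4*status≤square (4 + t))))
                  (*-monoʳ-≤ (3 + t) (4*status≤square (4 + u))) ⟩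
    Lp                                                          ∎
    where
    distribute : ∀ σ t u A₁ A₂ P Q → 4 * ((8 + σ) * (A₁ + A₂) + (3 + u) * P + (3 + t) * Q)
                                    ≡ (8 + σ) * (4 * A₁ + 4 * A₂) + (3 + u) * (4 * P) + (3 + t) * (4 * Q)
    distribute = solve-∀
  lower : Rp ≤ 4 * rhs + (10 + σ)
  lower = begin
    Rp                                                         ≤⟨ +-monoˡ-≤ (4 * (8 + σ)) (+-monoˡ-≤ 8 (+-monoˡ-≤ (16 * (6 + σ))
                                                                    (*-monoʳ-≤ (10 + σ) (square≤4*status+1 (6 + σ))))) ⟩
    (10 + σ) * (4 * Z + 1) + 16 * (6 + σ) + 8 + 4 * (8 + σ)     ≡⟨ distribute σ Z ⟨
    4 * rhs + (10 + σ)                                          ∎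
    where
    distribute : ∀ σ Z → 4 * ((10 + σ) * Z + 4 * (6 + σ) + 2 + (8 + σ)) + (10 + σ)
                         ≡ (10 + σ) * (4 * Z + 1) + 16 * (6 + σ) + 8 + 4 * (8 + σ)
    distribute = solve-∀
  excess = σ * σ + 5 * σ + (6 + σ) * t * u
  expand : Rp + 10 ≡ Lp + (10 + σ) + excess
  expand = polynomial t u
    where
    polynomial : ∀ t u →
      (10 + (t + u)) * ((6 + (t + u)) * (6 + (t + u))) + 16 * (6 + (t + u)) + 8 + 4 * (8 + (t + u)) + 10 ≡
      (8 + (t + u)) * ((5 + t) * (5 + t) + (5 + u) * (5 + u)) + (3 + u) * ((4 + t) * (4 + t)) + (3 + t) * ((4 + u) * (4 + u))
      + (10 + (t + u)) + ((t + u) * (t + u) + 5 * (t + u) + (6 + (t + u)) * t * u)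
    polynomial = solve-∀
  11≤excess : 11 ≤ excess
  11≤excess = ≤-trans (m≤m+n 11 3) (≤-trans (+-mono-≤ (*-mono-≤ 2≤σ 2≤σ) (*-monoʳ-≤ 5 2≤σ)) (m≤m+n (σ * σ + 5 * σ) _))
  gap : suc (Lp + (10 + σ)) ≤ Rp
  gap = +-cancelʳ-≤ 10 _ _ (begin
    suc (Lp + (10 + σ)) + 10   ≡⟨ +-comm (suc (Lp + (10 + σ))) 10 ⟩
    10 + suc (Lp + (10 + σ))   ≡⟨ +-suc 10 (Lp + (10 + σ)) ⟩
    11 + (Lp + (10 + σ))       ≡⟨ +-comm 11 (Lp + (10 + σ)) ⟩
    Lp + (10 + σ) + 11         ≤⟨ +-monoʳ-≤ (Lp + (10 + σ)) 11≤excess ⟩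
    Lp + (10 + σ) + excess     ≡⟨ expand ⟨
    Rp + 10                    ∎)

Balanced : ℕ → ℕ → Set
Balanced n c = 4 ≤ c × 4 ≤ n ∸ c

module _ {m} (G : Graph (suc (suc m))) (undirected : Undirected G)
         (cycle⊆G : ∀ i j → cycleGraph (suc (suc m)) i j ≡ true → G i j ≡ true)
         {p q} (p<n : p < suc (suc m)) (q<n : q < suc (suc m)) (p≢q : p ≢ q)
         (chord : G (clamp (suc m) p) (clamp (suc m) q) ≡ true) where

  private
    n = suc (suc m)

  2*wiener+n≤status-bound : ∀ t u → n ≡ (4 + t) + (4 + u) → arc n p q ≡ 4 + t →
    2 * wiener G + n ≤ n * (status (5 + t) + status (5 + u)) + (3 + u) * status (4 + t) + (3 + t) * status (4 + u)
  2*wiener+n≤status-bound t u n≡ c≡ = begin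
    2 * wiener G + n                                     ≤⟨ +-monoˡ-≤ n (2*wiener≤pairBound G undirected cycle⊆G p<n q<n p≢q chord) ⟩
    ∑ n (λ a → ∑ n (pairBound n (arc n p q) a)) + n     ≡⟨ cong (λ c → ∑ n (λ a → ∑ n (pairBound n c a)) + n) c≡ ⟩
    ∑ n (λ a → ∑ n (pairBound n (4 + t) a)) + n         ≡⟨ pairBound-total (3 + t) (3 + u) n≡ ⟩
    n * (status (5 + t) + status (5 + u)) + (3 + u) * status (4 + t) + (3 + t) * status (4 + u) ∎
    where
    open ≤-Reasoning

  wiener-<-Cn3 : 10 ≤ n → Balanced n (arc n p q) → wiener G < wiener (Cn3 n)
  wiener-<-Cn3 10≤n (4≤c , 4≤d) with m≤n⇒∃[o]m+o≡n 4≤c | m≤n⇒∃[o]m+o≡n 4≤d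
  ... | t , t≡ | u , u≡ = *-cancelˡ-< 2 _ _ (+-cancelʳ-< n _ _ (begin-strict
    2 * wiener G + n
      ≤⟨ 2*wiener+n≤status-bound t u n≡ (sym t≡) ⟩
    n * (status (5 + t) + status (5 + u)) + (3 + u) * status (4 + t) + (3 + t) * status (4 + u)
      ≡⟨ cong (λ z → z * (status (5 + t) + status (5 + u)) + (3 + u) * status (4 + t) + (3 + t) * status (4 + u)) n≡8+σ ⟩
    (8 + σ) * (status (5 + t) + status (5 + u)) + (3 + u) * status (4 + t) + (3 + t) * status (4 + u)
      <⟨ status-inequality t u (+-cancelˡ-≤ 8 2 σ (subst (10 ≤_) n≡8+σ 10≤n)) ⟩
    (10 + σ) * status (6 + σ) + 4 * (6 + σ) + 2 + (8 + σ)
      ≡⟨ cong (λ z → (4 + z) * status z + 4 * z + 2 + (2 + z)) m≡ ⟨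
    (4 + m) * status m + 4 * m + 2 + n
      ≡⟨ cong (λ z → z * status m + 4 * m + 2 + n) (+-comm 4 m) ⟩
    (m + 4) * status m + 4 * m + 2 + n
      ≤⟨ +-monoˡ-≤ n (wiener-Cn3-≥ m (subst (0 <_) (sym m≡) z<s)) ⟩
    2 * wiener (Cn3 n) + n ∎))
    where
    open ≤-Reasoning
    σ = t + u
    n≡ : n ≡ (4 + t) + (4 + u)
    n≡ = trans (sym (m+[n∸m]≡n (<⇒≤ (arc<N n p q (<⇒≤ p<n) q<n)))) (cong₂ _+_ (sym t≡) (sym u≡))
    n≡8+σ : n ≡ 8 + σ
    n≡8+σ = trans n≡ (regroup t u)
      where regroup : ∀ t u → (4 + t) + (4 + u) ≡ 8 + (t + u)
            regroup = solve-∀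
    m≡ : m ≡ 6 + σ
    m≡ = suc-injective (suc-injective n≡8+σ)

-- A balanced edge of the triangle

arc-one : ∀ n x y → x < n → y < n → arc n x y ≡ 1 → Next n x y
arc-one n x y x<n y<n arc≡1 with arc-cases n x y (<⇒≤ x<n)
... | inj₁ eq = next-step′ (trans (+-comm 1 x) (subst (λ a → x + a ≡ y) arc≡1 eq)) y<n
... | inj₂ eq = next-wrap′ sx≡n y≡0
  where
  sx+0≡y+n : suc x + 0 ≡ y + n
  sx+0≡y+n = trans (trans (+-identityʳ (suc x)) (+-comm 1 x)) (subst (λ a → x + a ≡ y + n) arc≡1 eq)
  y≡0 : y ≡ 0
  y≡0 = n≤0⇒n≡0 (+-cancelʳ-≤ n y 0 (subst (_≤ n) sx+0≡y+n (subst (_≤ n) (sym (+-identityʳ (suc x))) x<n)))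
  sx≡n : suc x ≡ n
  sx≡n = trans (sym (+-identityʳ (suc x))) (trans sx+0≡y+n (cong (_+ n) y≡0))

2≤arc : ∀ n x y → x < n → y < n → x ≢ y → cycAdjℕ n x y ≡ false → 2 ≤ arc n x y
2≤arc n x y x<n y<n x≢y apart with arc n x y in eq
... | zero        = ⊥-elim (<-irrefl refl (subst (0 <_) eq (arc-pos n x y x<n y<n x≢y)))
... | suc zero    with () ← trans (sym (cycAdj⁺ (arc-one n x y x<n y<n eq))) apart
... | suc (suc _) = s≤s (s≤s z≤n)

arc+2≤ : ∀ n x y → x < n → y < n → x ≢ y → cycAdjℕ n y x ≡ false → arc n x y + 2 ≤ n
arc+2≤ n x y x<n y<n x≢y apart = begin
  arc n x y + 2           ≤⟨ +-monoʳ-≤ (arc n x y) (2≤arc n y x y<n x<n (x≢y ∘ sym) apart) ⟩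
  arc n x y + arc n y x   ≡⟨ cong (arc n x y +_) (arc-flip n x y x<n y<n x≢y) ⟩
  arc n x y + (n ∸ arc n x y) ≡⟨ m+[n∸m]≡n (<⇒≤ (arc<N n x y (<⇒≤ x<n) y<n)) ⟩
  n                       ∎
  where open ≤-Reasoning

arc-triangle : ∀ n x y z → x < n → y < n → z < n → x ≢ y → y ≢ z → z ≢ x →
               arc n x y + arc n y z + arc n z x ≡ 1 * n ⊎ arc n x y + arc n y z + arc n z x ≡ 2 * n
arc-triangle n x y z x<n y<n z<n x≢y y≢z z≢x
  with arc-winding n x y (<⇒≤ x<n) | arc-winding n y z (<⇒≤ y<n) | arc-winding n z x (<⇒≤ z<n)
... | j₁ , w₁ | j₂ , w₂ | j₃ , w₃ = windings (j₁ + j₂ + j₃) total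
  where
  open ≤-Reasoning
  a₁ = arc n x y
  a₂ = arc n y z
  a₃ = arc n z x
  total : a₁ + a₂ + a₃ ≡ (j₁ + j₂ + j₃) * n
  total = +-cancelˡ-≡ (x + y + z) _ _ (begin-equality
    x + y + z + (a₁ + a₂ + a₃)                       ≡⟨ regroup₁ x y z a₁ a₂ a₃ ⟩
    (x + a₁) + (y + a₂) + (z + a₃)                   ≡⟨ cong₂ _+_ (cong₂ _+_ w₁ w₂) w₃ ⟩
    (y + j₁ * n) + (z + j₂ * n) + (x + j₃ * n)       ≡⟨ regroup₂ x y z j₁ j₂ j₃ n ⟩
    x + y + z + (j₁ + j₂ + j₃) * n                   ∎)
    where
    regroup₁ : ∀ x y z a₁ a₂ a₃ → x + y + z + (a₁ + a₂ + a₃) ≡ (x + a₁) + (y + a₂) + (z + a₃)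
    regroup₁ = solve-∀
    regroup₂ : ∀ x y z j₁ j₂ j₃ n → (y + j₁ * n) + (z + j₂ * n) + (x + j₃ * n) ≡ x + y + z + (j₁ + j₂ + j₃) * n
    regroup₂ = solve-∀
  below : a₁ + a₂ + a₃ < 3 * n
  below = begin-strict
    a₁ + a₂ + a₃  <⟨ +-mono-< (+-mono-< (arc<N n x y (<⇒≤ x<n) y<n) (arc<N n y z (<⇒≤ y<n) z<n))
                              (arc<N n z x (<⇒≤ z<n) x<n) ⟩
    n + n + n     ≡⟨ thrice n ⟩
    3 * n         ∎
    where thrice : ∀ n → n + n + n ≡ 3 * n
          thrice = solve-∀
  windings : ∀ J → a₁ + a₂ + a₃ ≡ J * n → a₁ + a₂ + a₃ ≡ 1 * n ⊎ a₁ + a₂ + a₃ ≡ 2 * n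
  windings 0 eq = ⊥-elim (<-irrefl (sym eq) (<-≤-trans (arc-pos n x y x<n y<n x≢y) (≤-trans (m≤m+n a₁ a₂) (m≤m+n _ a₃))))
  windings 1 eq = inj₁ eq
  windings 2 eq = inj₂ eq
  windings (suc (suc (suc J))) eq = ⊥-elim (<⇒≱ below (begin
    3 * n                 ≤⟨ m≤m+n (3 * n) (J * n) ⟩
    3 * n + J * n         ≡⟨ *-distribʳ-+ n 3 J ⟨
    (3 + J) * n           ≡⟨ eq ⟨
    a₁ + a₂ + a₃          ∎))

balanced-flip : ∀ {n a} → a ≤ n → Balanced n (n ∸ a) → Balanced n a
balanced-flip {n} {a} a≤n (4≤n-a , 4≤n-[n-a]) = subst (4 ≤_) (m∸[m∸n]≡n a≤n) 4≤n-[n-a] , 4≤n-a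

one-of-three-balanced : ∀ {n a b c} → 10 ≤ n → 2 ≤ a → 2 ≤ b → 2 ≤ c → a + b + c ≡ n →
                        Balanced n a ⊎ Balanced n b ⊎ Balanced n c
one-of-three-balanced {n} {a} {b} {c} 10≤n 2≤a 2≤b 2≤c sum with 4 ≤? a | 4 ≤? b | 4 ≤? c
... | yes 4≤a | _ | _ = inj₁ (4≤a , subst (4 ≤_) (sym rest) (+-mono-≤ 2≤b 2≤c))
  where rest : n ∸ a ≡ b + c
        rest = trans (cong (_∸ a) (trans (sym sum) (+-assoc a b c))) (m+n∸m≡n a (b + c))
... | no _ | yes 4≤b | _ = inj₂ (inj₁ (4≤b , subst (4 ≤_) (sym rest) (+-mono-≤ 2≤a 2≤c)))
  where rest : n ∸ b ≡ a + c
        rest = trans (cong (_∸ b) (trans (sym sum) (shuffle a b c))) (m+n∸m≡n b (a + c))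
          where shuffle : ∀ a b c → a + b + c ≡ b + (a + c)
                shuffle = solve-∀
... | no _ | no _ | yes 4≤c = inj₂ (inj₂ (4≤c , subst (4 ≤_) (sym rest) (+-mono-≤ 2≤a 2≤b)))
  where rest : n ∸ c ≡ a + b
        rest = trans (cong (_∸ c) (sym sum)) (m+n∸n≡m (a + b) c)
... | no a≱4 | no b≱4 | no c≱4 = ⊥-elim (<⇒≱ (begin-strict
  n             ≡⟨ sum ⟨
  a + b + c     ≤⟨ +-mono-≤ (+-mono-≤ (≤-pred (≰⇒> a≱4)) (≤-pred (≰⇒> b≱4))) (≤-pred (≰⇒> c≱4)) ⟩
  9             <⟨ ≤-refl ⟩
  10            ∎) 10≤n)
  where open ≤-Reasoning

balanced-triangle-arc : ∀ n x y z → 10 ≤ n → x < n → y < n → z < n → x ≢ y → y ≢ z → z ≢ x →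
  cycAdjℕ n x y ≡ false → cycAdjℕ n y z ≡ false → cycAdjℕ n z x ≡ false →
  Balanced n (arc n x y) ⊎ Balanced n (arc n y z) ⊎ Balanced n (arc n z x)
balanced-triangle-arc n x y z 10≤n x<n y<n z<n x≢y y≢z z≢x xy yz zx
  with arc-triangle n x y z x<n y<n z<n x≢y y≢z z≢x
... | inj₁ once  = one-of-three-balanced 10≤n (2≤arc n x y x<n y<n x≢y xy) (2≤arc n y z y<n z<n y≢z yz)
                     (2≤arc n z x z<n x<n z≢x zx) (trans once (+-identityʳ n))
... | inj₂ twice = Sum.map (balanced-flip (<⇒≤ a₁<n)) (Sum.map (balanced-flip (<⇒≤ a₂<n)) (balanced-flip (<⇒≤ a₃<n)))
                     (one-of-three-balanced 10≤n (short x y x<n y<n x≢y yz′) (short y z y<n z<n y≢z zx′) (short z x z<n x<n z≢x xy′) complements)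
  where
  a₁ = arc n x y
  a₂ = arc n y z
  a₃ = arc n z x
  a₁<n = arc<N n x y (<⇒≤ x<n) y<n
  a₂<n = arc<N n y z (<⇒≤ y<n) z<n
  a₃<n = arc<N n z x (<⇒≤ z<n) x<n
  yz′ = trans (cycAdj-comm n y x) xy
  zx′ = trans (cycAdj-comm n z y) yz
  xy′ = trans (cycAdj-comm n x z) zx
  short : ∀ u v → u < n → v < n → u ≢ v → cycAdjℕ n v u ≡ false → 2 ≤ n ∸ arc n u v
  short u v u<n v<n u≢v apart = subst (_≤ n ∸ arc n u v) (m+n∸m≡n (arc n u v) 2)
                                  (∸-monoˡ-≤ (arc n u v) (arc+2≤ n u v u<n v<n u≢v apart))
  complements : (n ∸ a₁) + (n ∸ a₂) + (n ∸ a₃) ≡ n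
  complements = +-cancelˡ-≡ (a₁ + a₂ + a₃) _ _ (begin-equality
    a₁ + a₂ + a₃ + ((n ∸ a₁) + (n ∸ a₂) + (n ∸ a₃))        ≡⟨ regroup a₁ a₂ a₃ (n ∸ a₁) (n ∸ a₂) (n ∸ a₃) ⟩
    (a₁ + (n ∸ a₁)) + (a₂ + (n ∸ a₂)) + (a₃ + (n ∸ a₃))    ≡⟨ cong₂ _+_ (cong₂ _+_ (m+[n∸m]≡n (<⇒≤ a₁<n)) (m+[n∸m]≡n (<⇒≤ a₂<n)))
                                                                        (m+[n∸m]≡n (<⇒≤ a₃<n)) ⟩
    n + n + n                                              ≡⟨ thrice n ⟩
    2 * n + n                                              ≡⟨ cong (_+ n) twice ⟨
    a₁ + a₂ + a₃ + n                                       ∎)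
    where
    open ≤-Reasoning
    regroup : ∀ a₁ a₂ a₃ b₁ b₂ b₃ → a₁ + a₂ + a₃ + (b₁ + b₂ + b₃) ≡ (a₁ + b₁) + (a₂ + b₂) + (a₃ + b₃)
    regroup = solve-∀
    thrice : ∀ n → n + n + n ≡ 2 * n + n
    thrice = solve-∀

cycleTriangle-undirected : ∀ n u v w → Undirected (cycleTriangle n u v w)
cycleTriangle-undirected n u v w i j =
  cong₂ _∨_ (cycAdj-comm n (toℕ i) (toℕ j))
    (cong₂ _∨_ (samePair-comm (toℕ i) (toℕ j) _ _) (cong₂ _∨_ (samePair-comm (toℕ i) (toℕ j) _ _) (samePair-comm (toℕ i) (toℕ j) _ _)))

cycle⊆cycleTriangle : ∀ n u v w i j → cycleGraph n i j ≡ true → cycleTriangle n u v w i j ≡ true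
cycle⊆cycleTriangle n u v w i j = ∨-true⁺ˡ _

triangle-uv : ∀ n u v w → cycleTriangle n u v w u v ≡ true
triangle-uv n u v w = ∨-true⁺ʳ (cycleGraph n u v) (∨-true⁺ˡ _ (samePair-refl (toℕ u) (toℕ v)))

triangle-vw : ∀ n u v w → cycleTriangle n u v w v w ≡ true
triangle-vw n u v w = ∨-true⁺ʳ (cycleGraph n v w) (∨-true⁺ʳ (samePair (toℕ v) (toℕ w) (toℕ u) (toℕ v))
                        (∨-true⁺ˡ _ (samePair-refl (toℕ v) (toℕ w))))

triangle-wu : ∀ n u v w → cycleTriangle n u v w w u ≡ true
triangle-wu n u v w = ∨-true⁺ʳ (cycleGraph n w u) (∨-true⁺ʳ (samePair (toℕ w) (toℕ u) (toℕ u) (toℕ v))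
                        (∨-true⁺ʳ (samePair (toℕ w) (toℕ u) (toℕ v) (toℕ w)) (samePair-refl (toℕ w) (toℕ u))))

balanced-edge⇒wiener-< : ∀ {m} (u v w p q : Fin (suc (suc m))) → 10 ≤ suc (suc m) → p ≢ q →
  cycleTriangle (suc (suc m)) u v w p q ≡ true → Balanced (suc (suc m)) (arc (suc (suc m)) (toℕ p) (toℕ q)) →
  wiener (cycleTriangle (suc (suc m)) u v w) < wiener (Cn3 (suc (suc m)))
balanced-edge⇒wiener-< {m} u v w p q 10≤n p≢q edge =
  wiener-<-Cn3 (cycleTriangle n u v w) (cycleTriangle-undirected n u v w) (cycle⊆cycleTriangle n u v w)
    (toℕ<n p) (toℕ<n q) (p≢q ∘ toℕ-injective)
    (subst₂ (λ i j → cycleTriangle n u v w i j ≡ true) (sym (clamp-toℕ (suc m) p)) (sym (clamp-toℕ (suc m) q)) edge) 10≤n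
  where n = suc (suc m)

corollary2 : (n : ℕ) → 26 ≤ n → (u v w : Fin n)
    → u ≢ v → v ≢ w → w ≢ u
    → cycleGraph n u v ≡ false → cycleGraph n v w ≡ false → cycleGraph n w u ≡ false
    → wiener (cycleTriangle n u v w) < wiener (Cn3 n)
corollary2 (suc (suc m)) 26≤n u v w u≢v v≢w w≢u uv vw wu =
  Sum.[ balanced-edge⇒wiener-< u v w u v 10≤n u≢v (triangle-uv _ u v w)
      , Sum.[ balanced-edge⇒wiener-< u v w v w 10≤n v≢w (triangle-vw _ u v w)
            , balanced-edge⇒wiener-< u v w w u 10≤n w≢u (triangle-wu _ u v w) ]′ ]′
    (balanced-triangle-arc _ (toℕ u) (toℕ v) (toℕ w) 10≤n (toℕ<n u) (toℕ<n v) (toℕ<n w)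
      (u≢v ∘ toℕ-injective) (v≢w ∘ toℕ-injective) (w≢u ∘ toℕ-injective) uv vw wu)
  where 10≤n = ≤-trans (m≤m+n 10 16) 26≤n
corollary2 (suc zero) (s≤s ())
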